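{- If $v$ is an integer whose maximal prime power factors are all congruent to $1$ modulo $4$, then there exists a $(3v,3,4,1)$-BRDF.
   Context: Let $G$ be a finite group written additively, $H$ a subgroup of $G$, and $k\ge2$, $\lambda\ge1$ integers. A $(G,H,k,\lambda)$-relative difference family (RDF) is a set $\mathcal{F}$ of $k$-subsets of $G$ (base blocks) such that the multiset of differences $x-y$, over all ordered pairs $(x,y)$ of distinct elements lying in a common base block, contains every element of $G\setminus H$ exactly $\lambda$ times and contains no element of $H$. A $(G,H,k,\lambda)$-Banff relative difference family (BRDF) is a $(G,H,k,\lambda)$-RDF $\mathcal{F}$ such that additionally (a) every base block is disjoint from $H$, and (b) the sets $B$ and $-B=\{ -b:b\in B\}$, for $B\in\mathcal{F}$, are all pairwise disjoint (in particular $B\cap -B=\emptyset$). A $(g,h,k,\lambda)$-BRDF means a $(G,H,k,\lambda)$-BRDF for some group $G$ with $|G|=g$ and subgroup $H$ with $|H|=h$. -}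

module Defs where

open import Level using (0ℓ)
open import Data.Nat using (ℕ; suc; _^_; _%_; _≤_; _≥_)
open import Data.Nat.Divisibility using (_∣_)
open import Data.Nat.Primality using (Prime)
open import Data.Bool using (Bool; true; false)
open import Data.Fin using (Fin)
open import Data.List using (List; []; _∷_; length; map; concatMap; filter; lookup)
open import Data.List.Membership.Propositional using (_∈_; _∉_)
open import Data.List.Relation.Unary.Unique.Propositional using (Unique)
open import Data.Product using (Σ; _×_; _,_)
open import Relation.Nullary using (¬_; Dec)
open import Relation.Nullary.Decidable using (¬?)
open import Relation.Binary.PropositionalEquality using (_≡_; _≢_)
open import Algebra.Structures using (IsAbelianGroup)

record FiniteAbelianGroup : Set₁ where
  field
    Carrier  : Set
    _+_      : Carrier → Carrier → Carrier
    0#       : Carrier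
    -_       : Carrier → Carrier
    isAbelianGroup : IsAbelianGroup _≡_ _+_ 0# -_
    _≟_      : (x y : Carrier) → Dec (x ≡ y)
    elements : List Carrier
    complete : ∀ x → x ∈ elements
    distinct : Unique elements

  order : ℕ
  order = length elements

  _-_ : Carrier → Carrier → Carrier
  x - y = x + (- y)

record Subgroup (G : FiniteAbelianGroup) : Set where
  open FiniteAbelianGroup G using (Carrier; 0#; _+_; -_)
  field
    members  : List Carrier
    distinct : Unique members
    has-0    : 0# ∈ members
    +-closed : ∀ {x y} → x ∈ members → y ∈ members → (x + y) ∈ members
    neg-closed : ∀ {x} → x ∈ members → (- x) ∈ members

  order : ℕ
  order = length members

module _ (G : FiniteAbelianGroup) where
  open FiniteAbelianGroup G hiding (order)

  IsKSubset : ℕ → List Carrier → Set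
  IsKSubset k B = Unique B × length B ≡ k

  differences : List Carrier → List Carrier
  differences B = concatMap (λ x → map (λ y → x - y) (filter (λ y → ¬? (x ≟ y)) B)) B

  allDifferences : List (List Carrier) → List Carrier
  allDifferences F = concatMap differences F

  count : Carrier → List Carrier → ℕ
  count g xs = length (filter (g ≟_) xs)

  negSet : List Carrier → List Carrier
  negSet B = map -_ B

  signed : Bool → List Carrier → List Carrier
  signed true  B = B
  signed false B = negSet B

  Disjoint : List Carrier → List Carrier → Set
  Disjoint A B = ∀ {x} → x ∈ A → x ∉ B

  IsRDF : Subgroup G → ℕ → ℕ → List (List Carrier) → Set
  IsRDF H k λ' F =
    (∀ {B} → B ∈ F → IsKSubset k B) ×
    (∀ g → g ∉ Subgroup.members H → count g (allDifferences F) ≡ λ') ×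
    (∀ g → g ∈ Subgroup.members H → count g (allDifferences F) ≡ 0)

  IsBRDF : Subgroup G → ℕ → ℕ → List (List Carrier) → Set
  IsBRDF H k λ' F =
    IsRDF H k λ' F ×
    (∀ {B} → B ∈ F → Disjoint B (Subgroup.members H)) ×
    (∀ (i j : Fin (length F)) (s t : Bool) → (i , s) ≢ (j , t) →
       Disjoint (signed s (lookup F i)) (signed t (lookup F j)))

BRDFExists : ℕ → ℕ → ℕ → ℕ → Set₁
BRDFExists g h k λ' =
  Σ FiniteAbelianGroup λ G → Σ (Subgroup G) λ H → Σ (List (List (FiniteAbelianGroup.Carrier G))) λ F →
    FiniteAbelianGroup.order G ≡ g × Subgroup.order H ≡ h × IsBRDF G H k λ' F

MaximalPrimePowerFactor : ℕ → ℕ → ℕ → Set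
MaximalPrimePowerFactor v p e = Prime p × e ≥ 1 × (p ^ e) ∣ v × ¬ ((p ^ suc e) ∣ v)

{-# OPTIONS --safe #-}
module Submission where

-- For every prime power p^e ≡ 1 (mod 4) there is an abelian group of order p^e with an
-- automorphism J, J² = −1, on which doubling is invertible: if p ≡ 1 (mod 4), ℤ/p with J
-- multiplication by a square root s of −1 (if there were none, the group {±x, ±x⁻¹} would act
-- on ℤ/p ∖ {0, ±1} with orbits of size 4, forcing p ≡ 3 (mod 4)); if p ≡ 3 (mod 4), then e is
-- even and (ℤ/p)² with J (a , b) = (−b , a).  Their product is such a group R of order v.
-- In G = ℤ/3 × R with H = ℤ/3 × 0 take one base block {(1,x), (2,Jx), (1,−x), (2,−Jx)} for
-- each ⟨J⟩-orbit {x, Jx, −x, −Jx} of R ∖ 0.  The differences of this block with first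
-- coordinate 0 form the orbit of 2x, those with first coordinate 1 or 2 the orbit of Jx − x;
-- as doubling and J − 1 are automorphisms commuting with J, each element of G ∖ H occurs
-- exactly once.  The blocks ±B lie over pairwise distinct orbits, except B and −B, which
-- would meet only if Jx = ±x.

open import Defs hiding (count)
open import Algebra.Bundles using (AbelianGroup; CommutativeRing)
open import Algebra.Structures using (IsAbelianGroup)
import Algebra.Properties.AbelianGroup as AbelianGroupProperties
import Algebra.Properties.CommutativeSemigroup as CommutativeSemigroupProperties
import Algebra.Properties.Ring as RingProperties
open import Data.Bool using (Bool; true; false; _∧_; _xor_; if_then_else_)
open import Data.Bool.Properties using (xor-same)
open import Data.Empty using (⊥-elim)
open import Data.Fin as Fin using (Fin; zero; suc; toℕ)
open import Data.Fin.Properties using (toℕ-injective; toℕ-fromℕ<; toℕ<n)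
open import Data.List using (List; []; _∷_; _++_; length; map; filter; concatMap; lookup; cartesianProduct; allFin)
open import Data.List.Properties
  using (length-removeAt′; length-++; length-map; length-tabulate; filter-++; filter-none; filter-accept; filter-reject; filter-all; concatMap-map)
open import Data.List.Membership.Propositional using (_∈_; _∉_; _─_; find)
open import Data.List.Membership.Propositional.Properties
  using (∈-++⁺ˡ; ∈-++⁺ʳ; ∈-concatMap⁺; ∈-concatMap⁻; ∈-map⁻; ∈-filter⁺; ∈-filter⁻; ∈-allFin; ∈-cartesianProduct⁺)
open import Data.List.Relation.Binary.Permutation.Propositional using (_↭_; ↭-refl; ↭-prep; ↭-swap; ↭-trans; ↭-reflexive)
open import Data.List.Relation.Binary.Permutation.Propositional.Properties using (↭-length; ↭-reverse; filter-↭)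
open import Data.List.Relation.Binary.Pointwise using (Pointwise-≡⇒≡; []; _∷_)
open import Data.List.Relation.Binary.Subset.Propositional using (_⊆_)
open import Data.List.Relation.Unary.All using (All; []; _∷_)
open import Data.List.Relation.Unary.All.Properties using (¬Any⇒All¬)
open import Data.List.Relation.Unary.AllPairs using ([]; _∷_)
open import Data.List.Relation.Unary.Any as Any using (here; there; index; any?; satisfied)
open import Data.List.Relation.Unary.Unique.Propositional using (Unique)
open import Data.List.Relation.Unary.Unique.Propositional.Properties
  using (++⁺; Unique[x∷xs]⇒x∉xs; allFin⁺; cartesianProduct⁺; filter⁺)
open import Data.Nat as ℕ using (ℕ; zero; suc; _∸_; _≤_; _<_; z≤n; s≤s; NonZero; ≢-nonZero)
import Data.Nat.Properties as ℕ
open import Data.Nat.Coprimality as Coprime using (prime⇒coprime; coprime-Bézout)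
open import Data.Nat.DivMod
  using (_%_; _/_; _mod_; [m+n]%n≡m%n; [m+kn]%n≡m%n; m*n%n≡0; %-distribˡ-+; %-distribˡ-*; m<n⇒m%n≡m; n%n≡0; m≡m%n+[m/n]*n)
open import Data.Nat.Divisibility
  using (_∣_; _∤_; divides; _∣?_; ∣-refl; ∣-trans; ∣1⇒≡1; ∣m+n∣m⇒∣n; ∣m∣n⇒∣m+n; ∣m⇒∣m*n; ∣n⇒∣m*n; m∣m*n; *-monoʳ-∣; *-cancelˡ-∣)
open import Data.Nat.GCD using (module Bézout)
open import Data.Nat.Induction using (<-wellFounded)
open import Data.Nat.ListAction using (product)
open import Data.Nat.Primality using (Prime; euclidsLemma; prime⇒irreducible; prime⇒nonZero; prime⇒nonTrivial)
open import Data.Nat.Primality.Factorisation using (factorise)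
open import Data.Nat.Solver using (module +-*-Solver)
open import Data.Product as Product using (Σ; ∃; ∃₂; _×_; _,_; proj₁; proj₂)
open import Data.Product.Properties using (≡-dec)
open import Data.Sum using (_⊎_; inj₁; inj₂)
open import Function using (_∘_; flip; case_of_)
open import Induction.WellFounded using (Acc; acc)
open import Relation.Binary.Definitions using (DecidableEquality)
open import Relation.Binary.PropositionalEquality
  using (_≡_; _≢_; refl; sym; trans; cong; cong₂; subst; isEquivalence; module ≡-Reasoning)
open import Relation.Nullary using (Dec; yes; no)
open import Relation.Nullary.Decidable using (¬?)
open ≡-Reasoning

-- Counting in lists

module _ {A : Set} (_≟_ : DecidableEquality A) where

  count : A → List A → ℕ
  count g xs = length (filter (g ≟_) xs)

  count-++ : ∀ g xs ys → count g (xs ++ ys) ≡ count g xs ℕ.+ count g ys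
  count-++ g xs ys = trans (cong length (filter-++ (g ≟_) xs ys)) (length-++ (filter (g ≟_) xs))

  count-∷-≡ : ∀ {g x} xs → g ≡ x → count g (x ∷ xs) ≡ suc (count g xs)
  count-∷-≡ {g} _ g≡x = cong length (filter-accept (g ≟_) g≡x)

  count-∷-≢ : ∀ {g x} xs → g ≢ x → count g (x ∷ xs) ≡ count g xs
  count-∷-≢ {g} _ g≢x = cong length (filter-reject (g ≟_) g≢x)

  count-∉ : ∀ {g xs} → g ∉ xs → count g xs ≡ 0
  count-∉ {g} g∉xs = cong length (filter-none (g ≟_) (¬Any⇒All¬ _ g∉xs))

  count-∈ : ∀ {g xs} → Unique xs → g ∈ xs → count g xs ≡ 1
  count-∈ {xs = _ ∷ xs} u (here refl) = trans (count-∷-≡ xs refl) (cong suc (count-∉ (Unique[x∷xs]⇒x∉xs u)))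
  count-∈ {xs = _ ∷ xs} u@(_ ∷ u′) (there g∈xs) =
    trans (count-∷-≢ xs λ { refl → Unique[x∷xs]⇒x∉xs u g∈xs }) (count-∈ u′ g∈xs)

  count-↭ : ∀ g {xs ys} → xs ↭ ys → count g xs ≡ count g ys
  count-↭ g xs↭ys = ↭-length (filter-↭ (g ≟_) xs↭ys)

module _ {A B : Set} (_≟ᴬ_ : DecidableEquality A) (_≟ᴮ_ : DecidableEquality B) where

  count-map : ∀ (f : A → B) {a b} → f a ≡ b → (∀ {x} → f x ≡ b → x ≡ a) →
              ∀ xs → count _≟ᴮ_ b (map f xs) ≡ count _≟ᴬ_ a xs
  count-map f fa≡b _ [] = refl
  count-map f {a} {b} fa≡b f⁻¹b (x ∷ xs) with b ≟ᴮ f x | a ≟ᴬ x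
  ... | yes _     | yes _   = cong suc (count-map f fa≡b f⁻¹b xs)
  ... | yes b≡fx  | no a≢x  = ⊥-elim (a≢x (sym (f⁻¹b (sym b≡fx))))
  ... | no  b≢fx  | yes refl = ⊥-elim (b≢fx (sym fa≡b))
  ... | no  _     | no _    = count-map f fa≡b f⁻¹b xs

  private
    _≟ᴬᴮ_ : DecidableEquality (A × B)
    _≟ᴬᴮ_ = ≡-dec _≟ᴬ_ _≟ᴮ_

  count-× : ∀ a b xs → count _≟ᴬᴮ_ (a , b) xs ≡ count _≟ᴮ_ b (map proj₂ (filter ((a ≟ᴬ_) ∘ proj₁) xs))
  count-× a b [] = refl
  count-× a b ((c , d) ∷ xs) = by-cases (a ≟ᴬ c) (b ≟ᴮ d)
    where
    second : List (A × B) → List B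
    second = map proj₂ ∘ filter ((a ≟ᴬ_) ∘ proj₁)

    by-cases : Dec (a ≡ c) → Dec (b ≡ d) → count _≟ᴬᴮ_ (a , b) ((c , d) ∷ xs) ≡ count _≟ᴮ_ b (second ((c , d) ∷ xs))
    by-cases (yes refl) (yes refl) = begin
      count _≟ᴬᴮ_ (a , b) ((a , b) ∷ xs)  ≡⟨ count-∷-≡ _≟ᴬᴮ_ xs refl ⟩
      suc (count _≟ᴬᴮ_ (a , b) xs)        ≡⟨ cong suc (count-× a b xs) ⟩
      suc (count _≟ᴮ_ b (second xs))      ≡⟨ count-∷-≡ _≟ᴮ_ (second xs) refl ⟨
      count _≟ᴮ_ b (b ∷ second xs)        ≡⟨ cong (count _≟ᴮ_ b ∘ map proj₂) (filter-accept ((a ≟ᴬ_) ∘ proj₁) {xs = xs} refl) ⟨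
      count _≟ᴮ_ b (second ((a , b) ∷ xs)) ∎
    by-cases (yes refl) (no b≢d) = begin
      count _≟ᴬᴮ_ (a , b) ((a , d) ∷ xs)  ≡⟨ count-∷-≢ _≟ᴬᴮ_ xs (b≢d ∘ cong proj₂) ⟩
      count _≟ᴬᴮ_ (a , b) xs              ≡⟨ count-× a b xs ⟩
      count _≟ᴮ_ b (second xs)            ≡⟨ count-∷-≢ _≟ᴮ_ (second xs) b≢d ⟨
      count _≟ᴮ_ b (d ∷ second xs)        ≡⟨ cong (count _≟ᴮ_ b ∘ map proj₂) (filter-accept ((a ≟ᴬ_) ∘ proj₁) {xs = xs} refl) ⟨
      count _≟ᴮ_ b (second ((a , d) ∷ xs)) ∎
    by-cases (no a≢c) _ = begin
      count _≟ᴬᴮ_ (a , b) ((c , d) ∷ xs)  ≡⟨ count-∷-≢ _≟ᴬᴮ_ xs (a≢c ∘ cong proj₁) ⟩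
      count _≟ᴬᴮ_ (a , b) xs              ≡⟨ count-× a b xs ⟩
      count _≟ᴮ_ b (second xs)            ≡⟨ cong (count _≟ᴮ_ b ∘ map proj₂) (filter-reject ((a ≟ᴬ_) ∘ proj₁) {xs = xs} a≢c) ⟨
      count _≟ᴮ_ b (second ((c , d) ∷ xs)) ∎

  count-concatMap-cong : ∀ {C : Set} {a b} (f : C → List A) (g : C → List B) xs →
                         (∀ {x} → x ∈ xs → count _≟ᴬ_ a (f x) ≡ count _≟ᴮ_ b (g x)) →
                         count _≟ᴬ_ a (concatMap f xs) ≡ count _≟ᴮ_ b (concatMap g xs)
  count-concatMap-cong f g [] _ = refl
  count-concatMap-cong {a = a} {b} f g (x ∷ xs) f≈g = begin
    count _≟ᴬ_ a (f x ++ concatMap f xs)             ≡⟨ count-++ _≟ᴬ_ a (f x) _ ⟩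
    count _≟ᴬ_ a (f x) ℕ.+ count _≟ᴬ_ a (concatMap f xs) ≡⟨ cong₂ ℕ._+_ (f≈g (here refl)) (count-concatMap-cong f g xs (f≈g ∘ there)) ⟩
    count _≟ᴮ_ b (g x) ℕ.+ count _≟ᴮ_ b (concatMap g xs) ≡⟨ count-++ _≟ᴮ_ b (g x) _ ⟨
    count _≟ᴮ_ b (g x ++ concatMap g xs)             ∎

module _ {A : Set} where

  ∈-─ : ∀ {x z : A} {xs} (x∈xs : x ∈ xs) → z ∈ xs → z ≢ x → z ∈ xs ─ x∈xs
  ∈-─ (here refl) (here refl) z≢x = ⊥-elim (z≢x refl)
  ∈-─ (here _)    (there z∈xs) _  = z∈xs
  ∈-─ (there _)   (here refl) _   = here refl
  ∈-─ (there x∈xs) (there z∈xs) z≢x = there (∈-─ x∈xs z∈xs z≢x)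

  length-mono-⊆ : ∀ {xs ys : List A} → Unique xs → xs ⊆ ys → length xs ≤ length ys
  length-mono-⊆ {[]}     _               _     = z≤n
  length-mono-⊆ {x ∷ xs} {ys} u@(_ ∷ u′) xs⊆ys =
    subst (suc (length xs) ≤_) (sym (length-removeAt′ ys (index x∈ys)))
      (s≤s (length-mono-⊆ u′ λ z∈xs → ∈-─ x∈ys (xs⊆ys (there z∈xs)) λ { refl → Unique[x∷xs]⇒x∉xs u z∈xs }))
    where
    x∈ys : x ∈ ys
    x∈ys = xs⊆ys (here refl)

  Unique-++⁻ʳ : ∀ xs {ys : List A} → Unique (xs ++ ys) → Unique ys
  Unique-++⁻ʳ []       ys! = ys!
  Unique-++⁻ʳ (_ ∷ xs) (_ ∷ xs++ys!) = Unique-++⁻ʳ xs xs++ys!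

  Unique-++⇒∉ : ∀ xs {ys : List A} {z} → Unique (xs ++ ys) → z ∈ xs → z ∉ ys
  Unique-++⇒∉ (_ ∷ xs) xs++ys! (here refl) z∈ys = Unique[x∷xs]⇒x∉xs xs++ys! (∈-++⁺ʳ xs z∈ys)
  Unique-++⇒∉ (_ ∷ xs) (_ ∷ xs++ys!) (there z∈xs) = Unique-++⇒∉ xs xs++ys! z∈xs

  length-⊆-antisym : ∀ {xs ys : List A} → Unique xs → Unique ys → xs ⊆ ys → ys ⊆ xs → length xs ≡ length ys
  length-⊆-antisym xs! ys! xs⊆ys ys⊆xs = ℕ.≤-antisym (length-mono-⊆ xs! xs⊆ys) (length-mono-⊆ ys! ys⊆xs)

-- Orbits

-- The maps x ↦ ±ρᵇ x form a group of order 4, cyclic if ρ² = −1 (ε = true) and the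
-- Klein four-group if ρ² = 1 (ε = false); orbit x is the orbit of x under this group.
module SignedOrbits {A : Set} (-_ ρ : A → A) (ε : Bool)
  (-‿involutive : ∀ x → - (- x) ≡ x)
  (ρ-‿comm : ∀ x → ρ (- x) ≡ - ρ x)
  (ρ-ρ : ∀ x → ρ (ρ x) ≡ (if ε then - x else x))
  where

  sign rot : Bool → A → A
  sign a x = if a then - x else x
  rot b x = if b then ρ x else x

  act : Bool → Bool → A → A
  act a b x = sign a (rot b x)

  orbit : A → List A
  orbit x = x ∷ ρ x ∷ - x ∷ - ρ x ∷ []

  act-∈-orbit : ∀ a b x → act a b x ∈ orbit x
  act-∈-orbit false false x = here refl
  act-∈-orbit false true  x = there (here refl)
  act-∈-orbit true  false x = there (there (here refl))
  act-∈-orbit true  true  x = there (there (there (here refl)))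

  ∈-orbit⇒act : ∀ {x z} → z ∈ orbit x → ∃₂ λ a b → z ≡ act a b x
  ∈-orbit⇒act (here z≡)                         = false , false , z≡
  ∈-orbit⇒act (there (here z≡))                 = false , true  , z≡
  ∈-orbit⇒act (there (there (here z≡)))         = true  , false , z≡
  ∈-orbit⇒act (there (there (there (here z≡)))) = true  , true  , z≡

  sign-sign : ∀ a c x → sign a (sign c x) ≡ sign (a xor c) x
  sign-sign false c     x = refl
  sign-sign true  false x = refl
  sign-sign true  true  x = -‿involutive x

  rot-sign : ∀ b c x → rot b (sign c x) ≡ sign c (rot b x)
  rot-sign false c     x = refl
  rot-sign true  false x = refl
  rot-sign true  true  x = ρ-‿comm x

  rot-rot : ∀ b d x → rot b (rot d x) ≡ sign (b ∧ d ∧ ε) (rot (b xor d) x)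
  rot-rot false d     x = refl
  rot-rot true  false x = refl
  rot-rot true  true  x = ρ-ρ x

  act-act : ∀ a b c d x → act a b (act c d x) ≡ act ((a xor c) xor (b ∧ d ∧ ε)) (b xor d) x
  act-act a b c d x = begin
    sign a (rot b (sign c (rot d x)))                     ≡⟨ cong (sign a) (rot-sign b c (rot d x)) ⟩
    sign a (sign c (rot b (rot d x)))                     ≡⟨ sign-sign a c _ ⟩
    sign (a xor c) (rot b (rot d x))                      ≡⟨ cong (sign (a xor c)) (rot-rot b d x) ⟩
    sign (a xor c) (sign (b ∧ d ∧ ε) (rot (b xor d) x))   ≡⟨ sign-sign (a xor c) _ _ ⟩
    act ((a xor c) xor (b ∧ d ∧ ε)) (b xor d) x           ∎

  act-inverse : ∀ a b x → act (a xor (b ∧ ε)) b (act a b x) ≡ x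
  act-inverse a b x = trans (act-act (a xor (b ∧ ε)) b a b x) (cong₂ (λ c d → act c d x) (cancel a b ε) (xor-same b))
    where
    cancel : ∀ a b e → ((a xor (b ∧ e)) xor a) xor (b ∧ b ∧ e) ≡ false
    cancel false false e     = refl
    cancel false true  false = refl
    cancel false true  true  = refl
    cancel true  false e     = refl
    cancel true  true  false = refl
    cancel true  true  true  = refl

  orbit-shared : ∀ {x y z} → z ∈ orbit x → z ∈ orbit y → x ∈ orbit y
  orbit-shared {x} {y} z∈x z∈y with ∈-orbit⇒act z∈x | ∈-orbit⇒act z∈y
  ... | a , b , refl | c , d , abx≡cdy = subst (_∈ orbit y) (sym x≡) (act-∈-orbit ((a′ xor c) xor (b ∧ d ∧ ε)) (b xor d) y)
    where
    a′ : Bool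
    a′ = a xor (b ∧ ε)
    x≡ : x ≡ act ((a′ xor c) xor (b ∧ d ∧ ε)) (b xor d) y
    x≡ = begin
      x                     ≡⟨ act-inverse a b x ⟨
      act a′ b (act a b x)  ≡⟨ cong (act a′ b) abx≡cdy ⟩
      act a′ b (act c d y)  ≡⟨ act-act a′ b c d y ⟩
      act ((a′ xor c) xor (b ∧ d ∧ ε)) (b xor d) y ∎

module OrbitRepresentatives {A : Set} (_≟_ : DecidableEquality A) (orbit : A → List A)
  (∈-orbit : ∀ x → x ∈ orbit x)
  (orbit-shared : ∀ {x y z} → z ∈ orbit x → z ∈ orbit y → x ∈ orbit y)
  where

  open import Data.List.Membership.DecPropositional _≟_ using (_∈?_)

  representatives : List A → List A
  representatives [] = []
  representatives (x ∷ xs) with x ∈? concatMap orbit (representatives xs)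
  ... | yes _ = representatives xs
  ... | no  _ = x ∷ representatives xs

  covered : List A → List A
  covered xs = concatMap orbit (representatives xs)

  orbit-shared-concatMap : ∀ ys {x z} → z ∈ orbit x → z ∈ concatMap orbit ys → x ∈ concatMap orbit ys
  orbit-shared-concatMap ys z∈x z∈ =
    ∈-concatMap⁺ orbit {xs = ys} (Any.map (λ {r} → orbit-shared {y = r} z∈x) (∈-concatMap⁻ orbit z∈))

  representatives-⊆ : ∀ xs → representatives xs ⊆ xs
  representatives-⊆ (x ∷ xs) r∈ with x ∈? covered xs
  representatives-⊆ (x ∷ xs) r∈          | yes _ = there (representatives-⊆ xs r∈)
  representatives-⊆ (x ∷ xs) (here r≡x)  | no  _ = here r≡x
  representatives-⊆ (x ∷ xs) (there r∈)  | no  _ = there (representatives-⊆ xs r∈)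

  ⊆-covered : ∀ xs → xs ⊆ covered xs
  ⊆-covered (x ∷ xs) z∈ with x ∈? covered xs
  ⊆-covered (x ∷ xs) (here refl) | yes x∈ = x∈
  ⊆-covered (x ∷ xs) (there z∈)  | yes _  = ⊆-covered xs z∈
  ⊆-covered (x ∷ xs) (here refl) | no _   = ∈-++⁺ˡ (∈-orbit x)
  ⊆-covered (x ∷ xs) (there z∈)  | no _   = ∈-++⁺ʳ (orbit x) (⊆-covered xs z∈)

  covered-unique : ∀ xs → (∀ {x} → x ∈ xs → Unique (orbit x)) → Unique (covered xs)
  covered-unique [] _ = []
  covered-unique (x ∷ xs) orbit! with x ∈? covered xs
  ... | yes _  = covered-unique xs (orbit! ∘ there)
  ... | no x∉ = ++⁺ (orbit! (here refl)) (covered-unique xs (orbit! ∘ there))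
                    λ (z∈x , z∈) → x∉ (orbit-shared-concatMap (representatives xs) z∈x z∈)

-- Finite abelian groups and ℤ/n

isAbelianGroup-≡ : ∀ {A : Set} {_+_ : A → A → A} {0# : A} { -_ : A → A} →
                   (∀ a b c → (a + b) + c ≡ a + (b + c)) → (∀ a → 0# + a ≡ a) →
                   (∀ a → (- a) + a ≡ 0#) → (∀ a b → a + b ≡ b + a) →
                   IsAbelianGroup _≡_ _+_ 0# -_
isAbelianGroup-≡ {_+_ = _+_} {0#} { -_ } assoc identityˡ inverseˡ comm = record
  { isGroup = record
    { isMonoid = record
      { isSemigroup = record { isMagma = record { isEquivalence = isEquivalence ; ∙-cong = cong₂ _+_ } ; assoc = assoc }
      ; identity = identityˡ , λ a → trans (comm a 0#) (identityˡ a) }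
    ; inverse = inverseˡ , λ a → trans (comm a (- a)) (inverseˡ a)
    ; ⁻¹-cong = cong -_ }
  ; comm = comm }

module GroupProperties (G : FiniteAbelianGroup) where
  open FiniteAbelianGroup G hiding (order)
  open IsAbelianGroup isAbelianGroup public using (assoc; comm; identityˡ; identityʳ; inverseˡ; inverseʳ)

  abelianGroup : AbelianGroup _ _
  abelianGroup = record { isAbelianGroup = isAbelianGroup }

  open AbelianGroupProperties abelianGroup public
    using (⁻¹-involutive; ⁻¹-injective; ε⁻¹≈ε; inverseʳ-unique; identityˡ-unique; x∙y⁻¹≈ε⇒x≈y; ⁻¹-∙-comm)
  open CommutativeSemigroupProperties (AbelianGroup.commutativeSemigroup abelianGroup) public
    using (interchange)

  -‿+ : ∀ x y → - (x + y) ≡ (- x) + (- y)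
  -‿+ x y = sym (⁻¹-∙-comm x y)

  module Endomorphism (f : Carrier → Carrier) (f-+ : ∀ x y → f (x + y) ≡ f x + f y) where

    f-0 : f 0# ≡ 0#
    f-0 = identityˡ-unique (f 0#) (f 0#) (trans (sym (f-+ 0# 0#)) (cong f (identityˡ 0#)))

    f-‿ : ∀ x → f (- x) ≡ - f x
    f-‿ x = inverseʳ-unique (f x) (f (- x)) (trans (sym (f-+ x (- x))) (trans (cong f (inverseʳ x)) f-0))

    f-- : ∀ x y → f (x - y) ≡ f x - f y
    f-- x y = trans (f-+ x (- y)) (cong (f x +_) (f-‿ y))

_×ᴳ_ : FiniteAbelianGroup → FiniteAbelianGroup → FiniteAbelianGroup
G ×ᴳ H = record
  { Carrier        = G.Carrier × H.Carrier
  ; _+_            = λ (a , b) (c , d) → (a G.+ c) , (b H.+ d)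
  ; 0#             = G.0# , H.0#
  ; -_             = λ (a , b) → (G.- a) , (H.- b)
  ; isAbelianGroup = isAbelianGroup-≡
      (λ _ _ _ → cong₂ _,_ (G′.assoc _ _ _) (H′.assoc _ _ _))
      (λ _ → cong₂ _,_ (G′.identityˡ _) (H′.identityˡ _))
      (λ _ → cong₂ _,_ (G′.inverseˡ _) (H′.inverseˡ _))
      (λ _ _ → cong₂ _,_ (G′.comm _ _) (H′.comm _ _))
  ; _≟_            = ≡-dec G._≟_ H._≟_
  ; elements       = cartesianProduct G.elements H.elements
  ; complete       = λ (a , b) → ∈-cartesianProduct⁺ (G.complete a) (H.complete b)
  ; distinct       = cartesianProduct⁺ G.distinct H.distinct
  }
  where
  module G = FiniteAbelianGroup G
  module H = FiniteAbelianGroup H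
  module G′ = GroupProperties G
  module H′ = GroupProperties H

length-cartesianProduct : ∀ {A B : Set} (xs : List A) (ys : List B) →
                          length (cartesianProduct xs ys) ≡ length xs ℕ.* length ys
length-cartesianProduct []       ys = refl
length-cartesianProduct (x ∷ xs) ys = begin
  length (map (x ,_) ys ++ cartesianProduct xs ys)         ≡⟨ length-++ (map (x ,_) ys) ⟩
  length (map (x ,_) ys) ℕ.+ length (cartesianProduct xs ys) ≡⟨ cong₂ ℕ._+_ (length-map _ ys) (length-cartesianProduct xs ys) ⟩
  length ys ℕ.+ length xs ℕ.* length ys                      ∎

order-×ᴳ : ∀ G H → FiniteAbelianGroup.order (G ×ᴳ H) ≡ FiniteAbelianGroup.order G ℕ.* FiniteAbelianGroup.order H
order-×ᴳ G H = length-cartesianProduct (FiniteAbelianGroup.elements G) (FiniteAbelianGroup.elements H)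

module Modular (n : ℕ) .{{_ : NonZero n}} where

  [_] : ℕ → Fin n
  [ k ] = k mod n

  toℕ-[] : ∀ k → toℕ [ k ] ≡ k % n
  toℕ-[] k = toℕ-fromℕ< _

  []-toℕ : ∀ a → [ toℕ a ] ≡ a
  []-toℕ a = toℕ-injective (trans (toℕ-[] (toℕ a)) (m<n⇒m%n≡m (toℕ<n a)))

  []-≡ : ∀ {k l} → k % n ≡ l % n → [ k ] ≡ [ l ]
  []-≡ {k} {l} eq = toℕ-injective (trans (toℕ-[] k) (trans eq (sym (toℕ-[] l))))

  infix  8 -_
  infixl 7 _*_
  infixl 6 _+_ _-_

  _+_ _*_ : Fin n → Fin n → Fin n
  a + b = [ toℕ a ℕ.+ toℕ b ]
  a * b = [ toℕ a ℕ.* toℕ b ]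

  -_ : Fin n → Fin n
  - a = [ n ∸ toℕ a ]

  _-_ : Fin n → Fin n → Fin n
  a - b = a + - b

  0# 1# : Fin n
  0# = [ 0 ]
  1# = [ 1 ]

  []-+ : ∀ k l → [ k ] + [ l ] ≡ [ k ℕ.+ l ]
  []-+ k l = []-≡ (begin
    (toℕ [ k ] ℕ.+ toℕ [ l ]) % n ≡⟨ cong₂ (λ a b → (a ℕ.+ b) % n) (toℕ-[] k) (toℕ-[] l) ⟩
    (k % n ℕ.+ l % n) % n        ≡⟨ %-distribˡ-+ k l n ⟨
    (k ℕ.+ l) % n                ∎)

  []-* : ∀ k l → [ k ] * [ l ] ≡ [ k ℕ.* l ]
  []-* k l = []-≡ (begin
    (toℕ [ k ] ℕ.* toℕ [ l ]) % n ≡⟨ cong₂ (λ a b → (a ℕ.* b) % n) (toℕ-[] k) (toℕ-[] l) ⟩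
    (k % n ℕ.* (l % n)) % n      ≡⟨ %-distribˡ-* k l n ⟨
    (k ℕ.* l) % n                ∎)

  +-[]ˡ : ∀ k b → [ k ] + b ≡ [ k ℕ.+ toℕ b ]
  +-[]ˡ k b = trans (cong ([ k ] +_) (sym ([]-toℕ b))) ([]-+ k (toℕ b))

  +-[]ʳ : ∀ a k → a + [ k ] ≡ [ toℕ a ℕ.+ k ]
  +-[]ʳ a k = trans (cong (_+ [ k ]) (sym ([]-toℕ a))) ([]-+ (toℕ a) k)

  *-[]ˡ : ∀ k b → [ k ] * b ≡ [ k ℕ.* toℕ b ]
  *-[]ˡ k b = trans (cong ([ k ] *_) (sym ([]-toℕ b))) ([]-* k (toℕ b))

  *-[]ʳ : ∀ a k → a * [ k ] ≡ [ toℕ a ℕ.* k ]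
  *-[]ʳ a k = trans (cong (_* [ k ]) (sym ([]-toℕ a))) ([]-* (toℕ a) k)

  +-assoc : ∀ a b c → a + b + c ≡ a + (b + c)
  +-assoc a b c = trans (+-[]ˡ _ c) (trans (cong [_] (ℕ.+-assoc (toℕ a) (toℕ b) (toℕ c))) (sym (+-[]ʳ a _)))

  +-comm : ∀ a b → a + b ≡ b + a
  +-comm a b = cong [_] (ℕ.+-comm (toℕ a) (toℕ b))

  +-identityˡ : ∀ a → 0# + a ≡ a
  +-identityˡ a = trans (+-[]ˡ 0 a) ([]-toℕ a)

  -‿inverseˡ : ∀ a → - a + a ≡ 0#
  -‿inverseˡ a = trans (+-[]ˡ (n ∸ toℕ a) a)
    ([]-≡ (trans (cong (_% n) (ℕ.m∸n+n≡m (ℕ.<⇒≤ (toℕ<n a)))) (trans (n%n≡0 n) (sym (m*n%n≡0 0 n)))))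

  *-assoc : ∀ a b c → a * b * c ≡ a * (b * c)
  *-assoc a b c = trans (*-[]ˡ _ c) (trans (cong [_] (ℕ.*-assoc (toℕ a) (toℕ b) (toℕ c))) (sym (*-[]ʳ a _)))

  *-comm : ∀ a b → a * b ≡ b * a
  *-comm a b = cong [_] (ℕ.*-comm (toℕ a) (toℕ b))

  *-identityˡ : ∀ a → 1# * a ≡ a
  *-identityˡ a = trans (*-[]ˡ 1 a) (trans (cong [_] (ℕ.*-identityˡ (toℕ a))) ([]-toℕ a))

  *-distribˡ-+ : ∀ a b c → a * (b + c) ≡ a * b + a * c
  *-distribˡ-+ a b c = trans (*-[]ʳ a _) (trans (cong [_] (ℕ.*-distribˡ-+ (toℕ a) (toℕ b) (toℕ c))) (sym ([]-+ _ _)))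

  isAbelianGroup : IsAbelianGroup _≡_ _+_ 0# (-_)
  isAbelianGroup = isAbelianGroup-≡ +-assoc +-identityˡ -‿inverseˡ +-comm

  commutativeRing : CommutativeRing _ _
  commutativeRing = record
    { isCommutativeRing = record
      { isRing = record
        { +-isAbelianGroup = isAbelianGroup
        ; *-cong           = cong₂ _*_
        ; *-assoc          = *-assoc
        ; *-identity       = *-identityˡ , λ a → trans (*-comm a 1#) (*-identityˡ a)
        ; distrib          = *-distribˡ-+ , λ a b c → trans (*-comm (b + c) a)
                               (trans (*-distribˡ-+ a b c) (cong₂ _+_ (*-comm a b) (*-comm a c)))
        }
      ; *-comm = *-comm
      }
    }

  group : FiniteAbelianGroup
  group = record
    { Carrier = Fin n ; _+_ = _+_ ; 0# = 0# ; -_ = (-_)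
    ; isAbelianGroup = isAbelianGroup
    ; _≟_ = Fin._≟_ ; elements = allFin n ; complete = ∈-allFin ; distinct = allFin⁺ n }

  order-group : FiniteAbelianGroup.order group ≡ n
  order-group = length-tabulate {n = n} (λ i → i)

  toℕ-0# : toℕ 0# ≡ 0
  toℕ-0# = trans (toℕ-[] 0) (m*n%n≡0 0 n)

  [1+k]+[1+k]≡1 : ∀ k → n ≡ suc (k ℕ.+ k) → [ suc k ] + [ suc k ] ≡ 1#
  [1+k]+[1+k]≡1 k refl = trans ([]-+ (suc k) (suc k))
    ([]-≡ {suc k ℕ.+ suc k} {1} (trans (cong (λ m → suc m % n) (ℕ.+-suc k k)) ([m+n]%n≡m%n 1 n)))

  open CommutativeRing commutativeRing using (zeroʳ; distribʳ)

  module Halving (h : Fin n) (h+h≡1 : h + h ≡ 1#) where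

    half : Fin n → Fin n
    half x = h * x

    half+half : ∀ x → half x + half x ≡ x
    half+half x = trans (sym (distribʳ x h h)) (trans (cong (_* x) h+h≡1) (*-identityˡ x))

    half-double : ∀ x → half (x + x) ≡ x
    half-double x = trans (*-distribˡ-+ h x x) (half+half x)

    double≡0⇒≡0 : ∀ {x} → x + x ≡ 0# → x ≡ 0#
    double≡0⇒≡0 {x} x+x≡0 = trans (sym (half-double x)) (trans (cong half x+x≡0) (zeroʳ h))

module Differences (G : FiniteAbelianGroup) where
  open FiniteAbelianGroup G hiding (order)

  private
    others : Carrier → List Carrier → List Carrier
    others x = filter (λ y → ¬? (x ≟ y))

    others-∷-≡ : ∀ x ys → others x (x ∷ ys) ≡ others x ys
    others-∷-≡ x ys = filter-reject (λ y → ¬? (x ≟ y)) (λ x≢x → x≢x refl)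

    others-∷-≢ : ∀ {x y} ys → x ≢ y → others x (y ∷ ys) ≡ y ∷ others x ys
    others-∷-≢ ys x≢y = filter-accept (λ y → ¬? (_ ≟ y)) x≢y

    others-fresh : ∀ {x ys} → All (x ≢_) ys → others x ys ≡ ys
    others-fresh {x} = filter-all (λ y → ¬? (x ≟ y))

  differences₄ : Carrier → Carrier → Carrier → Carrier → List Carrier
  differences₄ a b c d = (a - b) ∷ (a - c) ∷ (a - d) ∷ (b - a) ∷ (b - c) ∷ (b - d) ∷
                         (c - a) ∷ (c - b) ∷ (c - d) ∷ (d - a) ∷ (d - b) ∷ (d - c) ∷ []

  differences≡differences₄ : ∀ {a b c d} → Unique (a ∷ b ∷ c ∷ d ∷ []) →
                  differences G (a ∷ b ∷ c ∷ d ∷ []) ≡ differences₄ a b c d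
  differences≡differences₄ {a} {b} {c} {d} ((a≢b ∷ a≢c ∷ a≢d ∷ []) ∷ (b≢c ∷ b≢d ∷ []) ∷ (c≢d ∷ []) ∷ [] ∷ []) =
    cong₂ _++_ (cong (map (λ y → a - y)) others-a)
      (cong₂ _++_ (cong (map (λ y → b - y)) others-b)
        (cong₂ _++_ (cong (map (λ y → c - y)) others-c)
          (cong (_++ []) (cong (map (λ y → d - y)) others-d))))
    where
    B : List Carrier
    B = a ∷ b ∷ c ∷ d ∷ []
    others-a : others a B ≡ b ∷ c ∷ d ∷ []
    others-a = trans (others-∷-≡ a _) (others-fresh (a≢b ∷ a≢c ∷ a≢d ∷ []))
    others-b : others b B ≡ a ∷ c ∷ d ∷ []
    others-b = trans (others-∷-≢ _ (a≢b ∘ sym)) (cong (a ∷_) (trans (others-∷-≡ b _) (others-fresh (b≢c ∷ b≢d ∷ []))))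
    others-c : others c B ≡ a ∷ b ∷ d ∷ []
    others-c = trans (others-∷-≢ _ (a≢c ∘ sym)) (cong (a ∷_) (trans (others-∷-≢ _ (b≢c ∘ sym))
                 (cong (b ∷_) (trans (others-∷-≡ c _) (others-fresh (c≢d ∷ []))))))
    others-d : others d B ≡ a ∷ b ∷ c ∷ []
    others-d = trans (others-∷-≢ _ (a≢d ∘ sym)) (cong (a ∷_) (trans (others-∷-≢ _ (b≢d ∘ sym))
                 (cong (b ∷_) (trans (others-∷-≢ _ (c≢d ∘ sym)) (cong (c ∷_) (others-∷-≡ d []))))))

-- Prime fields and square roots of −1

prime>1 : ∀ {p} → Prime p → 1 < p
prime>1 {p} p-prime = ℕ.nonTrivial⇒n>1 p {{prime⇒nonTrivial p-prime}}

module PrimeField (p : ℕ) (p-prime : Prime p) where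

  instance
    p≢0 : NonZero p
    p≢0 = prime⇒nonZero p-prime

  open Modular p public
  open CommutativeRing commutativeRing public using (zeroˡ; zeroʳ; *-identityʳ; distribʳ; -‿inverseʳ)
  open RingProperties (CommutativeRing.ring commutativeRing) public using (-‿distribˡ-*; -‿distribʳ-*)
  open GroupProperties group public using (⁻¹-involutive; ⁻¹-injective; ε⁻¹≈ε; inverseʳ-unique; x∙y⁻¹≈ε⇒x≈y)

  1≢0 : 1# ≢ 0#
  1≢0 1≡0 = ℕ.1+n≢0 (begin
    1        ≡⟨ m<n⇒m%n≡m (prime>1 p-prime) ⟨
    1 % p    ≡⟨ toℕ-[] 1 ⟨
    toℕ 1#   ≡⟨ cong toℕ 1≡0 ⟩
    toℕ 0#   ≡⟨ toℕ-0# ⟩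
    0        ∎)

  ∃-inverse : ∀ {a} → a ≢ 0# → ∃ λ b → a * b ≡ 1#
  ∃-inverse {a} a≢0 with coprime-Bézout (Coprime.sym (prime⇒coprime p-prime {{≢-nonZero toℕa≢0}} (toℕ<n a)))
    where
    toℕa≢0 : toℕ a ≢ 0
    toℕa≢0 toℕa≡0 = a≢0 (toℕ-injective (trans toℕa≡0 (sym toℕ-0#)))
  ... | Bézout.+- x y 1+yp≡xa = [ x ] , (begin
    a * [ x ]           ≡⟨ *-[]ʳ a x ⟩
    [ toℕ a ℕ.* x ]     ≡⟨ cong [_] (ℕ.*-comm (toℕ a) x) ⟩
    [ x ℕ.* toℕ a ]     ≡⟨ cong [_] 1+yp≡xa ⟨
    [ 1 ℕ.+ y ℕ.* p ]   ≡⟨ []-≡ ([m+kn]%n≡m%n 1 y p) ⟩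
    1#                  ∎)
  ... | Bézout.-+ x y 1+xa≡yp = - [ x ] , (begin
    a * - [ x ]         ≡⟨ -‿distribʳ-* a [ x ] ⟨
    - (a * [ x ])       ≡⟨ cong -_ (inverseʳ-unique 1# (a * [ x ]) 1+a[x]≡0) ⟩
    - (- 1#)            ≡⟨ ⁻¹-involutive 1# ⟩
    1#                  ∎)
    where
    1+a[x]≡0 : 1# + a * [ x ] ≡ 0#
    1+a[x]≡0 = begin
      1# + a * [ x ]         ≡⟨ cong (1# +_) (*-[]ʳ a x) ⟩
      1# + [ toℕ a ℕ.* x ]   ≡⟨ []-+ 1 _ ⟩
      [ 1 ℕ.+ toℕ a ℕ.* x ]  ≡⟨ cong (λ m → [ 1 ℕ.+ m ]) (ℕ.*-comm (toℕ a) x) ⟩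
      [ 1 ℕ.+ x ℕ.* toℕ a ]  ≡⟨ cong [_] 1+xa≡yp ⟩
      [ y ℕ.* p ]            ≡⟨ []-≡ (trans (m*n%n≡0 y p) (sym (m*n%n≡0 0 p))) ⟩
      0#                     ∎

  inv : Fin p → Fin p
  inv a with a Fin.≟ 0#
  ... | yes _   = 0#
  ... | no a≢0 = proj₁ (∃-inverse a≢0)

  inv-0 : inv 0# ≡ 0#
  inv-0 with 0# Fin.≟ 0#
  ... | yes _  = refl
  ... | no 0≢0 = ⊥-elim (0≢0 refl)

  *-inverseʳ : ∀ {a} → a ≢ 0# → a * inv a ≡ 1#
  *-inverseʳ {a} a≢0 with a Fin.≟ 0#
  ... | yes a≡0 = ⊥-elim (a≢0 a≡0)
  ... | no a≢0′ = proj₂ (∃-inverse a≢0′)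

  *≡1⇒≢0 : ∀ a b → a * b ≡ 1# → a ≢ 0#
  *≡1⇒≢0 a b ab≡1 refl = 1≢0 (trans (sym ab≡1) (zeroˡ b))

  inv-unique : ∀ a b → a * b ≡ 1# → inv a ≡ b
  inv-unique a b ab≡1 = begin
    inv a                 ≡⟨ *-identityʳ (inv a) ⟨
    inv a * 1#            ≡⟨ cong (inv a *_) ab≡1 ⟨
    inv a * (a * b)       ≡⟨ *-assoc (inv a) a b ⟨
    inv a * a * b         ≡⟨ cong (_* b) (trans (*-comm (inv a) a) (*-inverseʳ (*≡1⇒≢0 a b ab≡1))) ⟩
    1# * b                ≡⟨ *-identityˡ b ⟩
    b                     ∎

  inv-involutive : ∀ a → inv (inv a) ≡ a
  inv-involutive a = case a Fin.≟ 0# of λ where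
    (yes a≡0)  → trans (cong (inv ∘ inv) a≡0) (trans (cong inv inv-0) (trans inv-0 (sym a≡0)))
    (no a≢0)   → inv-unique (inv a) a (trans (*-comm (inv a) a) (*-inverseʳ a≢0))

  inv-‿ : ∀ a → inv (- a) ≡ - inv a
  inv-‿ a = case a Fin.≟ 0# of λ where
    (yes a≡0)  → begin
      inv (- a)   ≡⟨ cong (inv ∘ -_) a≡0 ⟩
      inv (- 0#)  ≡⟨ cong inv ε⁻¹≈ε ⟩
      inv 0#      ≡⟨ inv-0 ⟩
      0#          ≡⟨ ε⁻¹≈ε ⟨
      - 0#        ≡⟨ cong -_ (trans (cong inv a≡0) inv-0) ⟨
      - inv a     ∎
    (no a≢0)   → inv-unique (- a) (- inv a) (begin
      - a * - inv a       ≡⟨ -‿distribˡ-* a (- inv a) ⟨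
      - (a * - inv a)     ≡⟨ cong -_ (-‿distribʳ-* a (inv a)) ⟨
      - - (a * inv a)     ≡⟨ ⁻¹-involutive _ ⟩
      a * inv a           ≡⟨ *-inverseʳ a≢0 ⟩
      1#                  ∎)

  inv-1 : inv 1# ≡ 1#
  inv-1 = inv-unique 1# 1# (*-identityˡ 1#)

  x²≡1⇒x≡±1 : ∀ {x} → x * x ≡ 1# → x ≡ 1# ⊎ x ≡ - 1#
  x²≡1⇒x≡±1 {x} x²≡1 with x + 1# Fin.≟ 0#
  ... | yes x+1≡0 = inj₂ (inverseʳ-unique 1# x (trans (+-comm 1# x) x+1≡0))
  ... | no x+1≢0  = inj₁ (x∙y⁻¹≈ε⇒x≈y x 1# (begin
    x - 1#                                     ≡⟨ *-identityˡ (x - 1#) ⟨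
    1# * (x - 1#)                              ≡⟨ cong (_* (x - 1#)) (trans (*-comm (inv (x + 1#)) (x + 1#)) (*-inverseʳ x+1≢0)) ⟨
    inv (x + 1#) * (x + 1#) * (x - 1#)         ≡⟨ *-assoc (inv (x + 1#)) (x + 1#) (x - 1#) ⟩
    inv (x + 1#) * ((x + 1#) * (x - 1#))       ≡⟨ cong (inv (x + 1#) *_) [x+1][x-1]≡0 ⟩
    inv (x + 1#) * 0#                          ≡⟨ zeroʳ (inv (x + 1#)) ⟩
    0#                                         ∎))
    where
    [x+1][x-1]≡0 : (x + 1#) * (x - 1#) ≡ 0#
    [x+1][x-1]≡0 = begin
      (x + 1#) * (x - 1#)                 ≡⟨ distribʳ (x - 1#) x 1# ⟩
      x * (x - 1#) + 1# * (x - 1#)        ≡⟨ cong₂ _+_ (*-distribˡ-+ x x (- 1#)) (*-identityˡ _) ⟩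
      (x * x + x * - 1#) + (x - 1#)       ≡⟨ cong (λ y → (x * x + y) + (x - 1#)) (trans (sym (-‿distribʳ-* x 1#)) (cong -_ (*-identityʳ x))) ⟩
      (x * x - x) + (x - 1#)              ≡⟨ +-assoc (x * x) (- x) (x - 1#) ⟩
      x * x + (- x + (x - 1#))            ≡⟨ cong (x * x +_) (+-assoc (- x) x (- 1#)) ⟨
      x * x + ((- x + x) - 1#)            ≡⟨ cong (λ y → x * x + (y - 1#)) (-‿inverseˡ x) ⟩
      x * x + (0# - 1#)                   ≡⟨ cong (x * x +_) (+-identityˡ (- 1#)) ⟩
      x * x - 1#                          ≡⟨ cong (_- 1#) x²≡1 ⟩
      1# - 1#                             ≡⟨ -‿inverseʳ 1# ⟩
      0#                                  ∎

module SquareRootOfMinusOne (q : ℕ) (p-prime : Prime (1 ℕ.+ q ℕ.* 4)) where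

  p : ℕ
  p = 1 ℕ.+ q ℕ.* 4

  open PrimeField p p-prime
  open import Data.List.Membership.DecPropositional (Fin._≟_ {p}) using (_∈?_)

  p-odd : p ≡ suc ((q ℕ.+ q) ℕ.+ (q ℕ.+ q))
  p-odd = cong suc (solve 1 (λ q → q :* con 4 := (q :+ q) :+ (q :+ q)) refl q)
    where open +-*-Solver

  open Halving [ suc (q ℕ.+ q) ] ([1+k]+[1+k]≡1 (q ℕ.+ q) p-odd) using (double≡0⇒≡0)

  exceptional : List (Fin p)
  exceptional = 0# ∷ 1# ∷ - 1# ∷ []

  Generic : Fin p → Set
  Generic x = x ∉ exceptional

  generic : List (Fin p)
  generic = filter (λ x → ¬? (x ∈? exceptional)) (allFin p)

  Generic-‿ : ∀ {x} → Generic x → Generic (- x)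
  Generic-‿ {x} x∉ -x∈ = x∉ (subst (_∈ exceptional) (⁻¹-involutive x) (closed -x∈))
    where
    closed : ∀ {c} → c ∈ exceptional → - c ∈ exceptional
    closed (here refl)                 = here ε⁻¹≈ε
    closed (there (here refl))         = there (there (here refl))
    closed (there (there (here refl))) = there (here (⁻¹-involutive 1#))

  Generic-inv : ∀ {x} → Generic x → Generic (inv x)
  Generic-inv {x} x∉ inv-x∈ = x∉ (subst (_∈ exceptional) (inv-involutive x) (closed inv-x∈))
    where
    closed : ∀ {c} → c ∈ exceptional → inv c ∈ exceptional
    closed (here refl)                 = here inv-0
    closed (there (here refl))         = there (here inv-1)
    closed (there (there (here refl))) = there (there (here (trans (inv-‿ 1#) (cong -_ inv-1))))

  module Klein = SignedOrbits -_ inv false ⁻¹-involutive inv-‿ inv-involutive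
  open Klein using (orbit)
  open OrbitRepresentatives Fin._≟_ orbit (λ x → here refl) Klein.orbit-shared

  Generic-orbit : ∀ {x z} → Generic x → z ∈ orbit x → Generic z
  Generic-orbit x-gen (here refl)                         = x-gen
  Generic-orbit x-gen (there (here refl))                 = Generic-inv x-gen
  Generic-orbit x-gen (there (there (here refl)))         = Generic-‿ x-gen
  Generic-orbit x-gen (there (there (there (here refl)))) = Generic-‿ (Generic-inv x-gen)

  ≢-‿self : ∀ {y} → y ≢ 0# → y ≢ - y
  ≢-‿self {y} y≢0 y≡-y = y≢0 (double≡0⇒≡0 (trans (cong (y +_) y≡-y) (-‿inverseʳ y)))

  1≢-1 : 1# ≢ - 1#
  1≢-1 = ≢-‿self 1≢0

  exceptional-unique : Unique exceptional
  exceptional-unique = ((1≢0 ∘ sym) ∷ (λ 0≡-1 → 1≢0 (trans (sym (⁻¹-involutive 1#)) (trans (cong -_ (sym 0≡-1)) ε⁻¹≈ε))) ∷ [])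
                     ∷ (1≢-1 ∷ [])
                     ∷ [] ∷ []

  generic⁺ : ∀ {x} → Generic x → x ∈ generic
  generic⁺ {x} = ∈-filter⁺ (λ x → ¬? (x ∈? exceptional)) (∈-allFin x)

  generic⁻ : ∀ {x} → x ∈ generic → Generic x
  generic⁻ = proj₂ ∘ ∈-filter⁻ (λ x → ¬? (x ∈? exceptional)) {xs = allFin p}

  generic-unique : Unique generic
  generic-unique = filter⁺ (λ x → ¬? (x ∈? exceptional)) (allFin⁺ p)

  p≡3+|generic| : p ≡ 3 ℕ.+ length generic
  p≡3+|generic| = trans (sym order-group)
    (length-⊆-antisym (allFin⁺ p) (++⁺ exceptional-unique generic-unique λ (x∈ , x∈g) → generic⁻ x∈g x∈)
                      all⊆ (λ {x} _ → ∈-allFin x))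
    where
    all⊆ : allFin p ⊆ exceptional ++ generic
    all⊆ {x} _ with x ∈? exceptional
    ... | yes x∈ = ∈-++⁺ˡ x∈
    ... | no x∉  = ∈-++⁺ʳ exceptional (generic⁺ x∉)

  length-concatMap-orbit : ∀ xs → length (concatMap orbit xs) ≡ length xs ℕ.* 4
  length-concatMap-orbit []       = refl
  length-concatMap-orbit (x ∷ xs) = cong (4 ℕ.+_) (length-concatMap-orbit xs)

  module _ (no-sqrt : ∀ s → s * s ≢ - 1#) where

    ≢inv : ∀ {x} → Generic x → x ≢ inv x
    ≢inv {x} x-gen x≡inv-x with x²≡1⇒x≡±1 (trans (cong (x *_) x≡inv-x) (*-inverseʳ (x-gen ∘ here)))
    ... | inj₁ x≡1  = x-gen (there (here x≡1))
    ... | inj₂ x≡-1 = x-gen (there (there (here x≡-1)))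

    ≢-inv : ∀ {x} → Generic x → x ≢ - inv x
    ≢-inv {x} x-gen x≡-inv-x = no-sqrt x (begin
      x * x          ≡⟨ cong (x *_) x≡-inv-x ⟩
      x * - inv x    ≡⟨ -‿distribʳ-* x (inv x) ⟨
      - (x * inv x)  ≡⟨ cong -_ (*-inverseʳ (x-gen ∘ here)) ⟩
      - 1#           ∎)

    orbit-unique : ∀ {x} → x ∈ generic → Unique (orbit x)
    orbit-unique {x} x∈ =
        (≢inv x-gen ∷ ≢-‿self x≢0 ∷ ≢-inv x-gen ∷ [])
      ∷ ((λ inv-x≡-x → ≢-inv x-gen (sym (trans (cong -_ inv-x≡-x) (⁻¹-involutive x))))
         ∷ ≢-‿self (Generic-inv x-gen ∘ here) ∷ [])
      ∷ ((≢inv x-gen ∘ ⁻¹-injective) ∷ [])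
      ∷ [] ∷ []
      where
      x-gen : Generic x
      x-gen = generic⁻ x∈
      x≢0 : x ≢ 0#
      x≢0 = x-gen ∘ here

    covered-⊆ : covered generic ⊆ generic
    covered-⊆ z∈ with find (∈-concatMap⁻ orbit {xs = representatives generic} z∈)
    ... | r , r∈ , z∈orbit-r = generic⁺ (Generic-orbit (generic⁻ (representatives-⊆ generic r∈)) z∈orbit-r)

    p≡3+4r : p ≡ 3 ℕ.+ length (representatives generic) ℕ.* 4
    p≡3+4r = begin
      p                                         ≡⟨ p≡3+|generic| ⟩
      3 ℕ.+ length generic                      ≡⟨ cong (3 ℕ.+_) (length-⊆-antisym generic-unique
                                                     (covered-unique generic orbit-unique) (⊆-covered generic) covered-⊆) ⟩
      3 ℕ.+ length (covered generic)            ≡⟨ cong (3 ℕ.+_) (length-concatMap-orbit (representatives generic)) ⟩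
      3 ℕ.+ length (representatives generic) ℕ.* 4 ∎

  ∃-sqrt-1 : ∃ λ s → s * s ≡ - 1#
  ∃-sqrt-1 with any? (λ s → s * s Fin.≟ - 1#) (allFin p)
  ... | yes found = satisfied found
  ... | no none   = ⊥-elim (1≢3 (begin
    1                                               ≡⟨ [m+kn]%n≡m%n 1 q 4 ⟨
    p % 4                                           ≡⟨ cong (_% 4) (p≡3+4r no-sqrt) ⟩
    (3 ℕ.+ length (representatives generic) ℕ.* 4) % 4 ≡⟨ [m+kn]%n≡m%n 3 (length (representatives generic)) 4 ⟩
    3                                               ∎))
    where
    1≢3 : 1 ≢ 3
    1≢3 ()
    no-sqrt : ∀ s → s * s ≢ - 1#
    no-sqrt s s²≡-1 = none (Any.map (λ { refl → s²≡-1 }) (∈-allFin s))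

-- Groups with a quarter turn

-- A ℤ[i]-module in which 2 is invertible: J is multiplication by i.
record QuarterTurnGroup : Set₁ where
  field
    group : FiniteAbelianGroup
  open FiniteAbelianGroup group hiding (order)
  field
    J           : Carrier → Carrier
    J-+         : ∀ x y → J (x + y) ≡ J x + J y
    J-J         : ∀ x → J (J x) ≡ - x
    half        : Carrier → Carrier
    half+half   : ∀ x → half x + half x ≡ x
    half-double : ∀ x → half (x + x) ≡ x

  order : ℕ
  order = FiniteAbelianGroup.order group

QuarterTurnGroupOfOrder : ℕ → Set₁
QuarterTurnGroupOfOrder n = Σ QuarterTurnGroup λ R → QuarterTurnGroup.order R ≡ n

ℤ-quarterTurn : ∀ n .{{_ : NonZero n}} (h s : Fin n) → let open Modular n in
                h + h ≡ 1# → s * s ≡ - 1# → QuarterTurnGroupOfOrder n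
ℤ-quarterTurn n h s h+h≡1 s²≡-1 = ℤₙ , order-group
  where
  open Modular n
  open Halving h h+h≡1
  open RingProperties (CommutativeRing.ring commutativeRing) using (-1*x≈-x)

  ℤₙ : QuarterTurnGroup
  ℤₙ = record
    { group       = group
    ; J           = s *_
    ; J-+         = *-distribˡ-+ s
    ; J-J         = λ x → trans (sym (*-assoc s s x)) (trans (cong (_* x) s²≡-1) (-1*x≈-x x))
    ; half        = half
    ; half+half   = half+half
    ; half-double = half-double
    }

ℤ²-quarterTurn : ∀ k → QuarterTurnGroupOfOrder (suc (k ℕ.+ k) ℕ.* suc (k ℕ.+ k))
ℤ²-quarterTurn k = ℤₙ² , trans (order-×ᴳ group group) (cong₂ ℕ._*_ order-group order-group)
  where
  open Modular (suc (k ℕ.+ k))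
  open Halving [ suc k ] ([1+k]+[1+k]≡1 k refl)
  open GroupProperties group using (-‿+)

  ℤₙ² : QuarterTurnGroup
  ℤₙ² = record
    { group       = group ×ᴳ group
    ; J           = λ (a , b) → - b , a
    ; J-+         = λ (a , b) (c , d) → cong (_, a + c) (-‿+ b d)
    ; J-J         = λ _ → refl
    ; half        = λ (a , b) → half a , half b
    ; half+half   = λ (a , b) → cong₂ _,_ (half+half a) (half+half b)
    ; half-double = λ (a , b) → cong₂ _,_ (half-double a) (half-double b)
    }

_⊗_ : ∀ {m n} → QuarterTurnGroupOfOrder m → QuarterTurnGroupOfOrder n → QuarterTurnGroupOfOrder (m ℕ.* n)
(R , |R|≡m) ⊗ (S , |S|≡n) = R⊗S , trans (order-×ᴳ R.group S.group) (cong₂ ℕ._*_ |R|≡m |S|≡n)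
  where
  module R = QuarterTurnGroup R
  module S = QuarterTurnGroup S

  R⊗S : QuarterTurnGroup
  R⊗S = record
    { group       = R.group ×ᴳ S.group
    ; J           = λ (a , b) → R.J a , S.J b
    ; J-+         = λ (a , b) (c , d) → cong₂ _,_ (R.J-+ a c) (S.J-+ b d)
    ; J-J         = λ (a , b) → cong₂ _,_ (R.J-J a) (S.J-J b)
    ; half        = λ (a , b) → R.half a , S.half b
    ; half+half   = λ (a , b) → cong₂ _,_ (R.half+half a) (S.half+half b)
    ; half-double = λ (a , b) → cong₂ _,_ (R.half-double a) (S.half-double b)
    }

ℤ₁-quarterTurn : QuarterTurnGroupOfOrder 1
ℤ₁-quarterTurn = ℤ-quarterTurn 1 zero zero refl refl

_⊗^_ : ∀ {n} → QuarterTurnGroupOfOrder n → ∀ e → QuarterTurnGroupOfOrder (n ℕ.^ e)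
R ⊗^ zero  = ℤ₁-quarterTurn
R ⊗^ suc e = R ⊗ (R ⊗^ e)

module QuarterTurnProperties (R : QuarterTurnGroup) where
  open QuarterTurnGroup R public
  open FiniteAbelianGroup group public hiding (order)
    renaming (_+_ to infixl 6 _+_; _-_ to infixl 6 _-_; -_ to infix 8 -_)
  open GroupProperties group public
  open Endomorphism J J-+ public using () renaming (f-0 to J-0; f-‿ to J-‿)

  double≡0⇒≡0 : ∀ {x} → x + x ≡ 0# → x ≡ 0#
  double≡0⇒≡0 {x} x+x≡0 = begin
    x              ≡⟨ half-double x ⟨
    half (x + x)   ≡⟨ cong half x+x≡0 ⟩
    half 0#        ≡⟨ cong half (identityˡ 0#) ⟨
    half (0# + 0#) ≡⟨ half-double 0# ⟩
    0#             ∎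

  ≡-‿⇒≡0 : ∀ {x} → x ≡ - x → x ≡ 0#
  ≡-‿⇒≡0 {x} x≡-x = double≡0⇒≡0 (trans (cong (x +_) x≡-x) (inverseʳ x))

  J≡⇒≡0 : ∀ {x} → J x ≡ x → x ≡ 0#
  J≡⇒≡0 {x} Jx≡x = ≡-‿⇒≡0 (sym (trans (sym (J-J x)) (trans (cong J Jx≡x) Jx≡x)))

  J≡-‿⇒≡0 : ∀ {x} → J x ≡ - x → x ≡ 0#
  J≡-‿⇒≡0 {x} Jx≡-x = ≡-‿⇒≡0 (sym (begin
    - x        ≡⟨ J-J x ⟨
    J (J x)    ≡⟨ cong J Jx≡-x ⟩
    J (- x)    ≡⟨ J-‿ x ⟩
    - J x      ≡⟨ cong -_ Jx≡-x ⟩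
    - - x      ≡⟨ ⁻¹-involutive x ⟩
    x          ∎))

  J≡0⇒≡0 : ∀ {x} → J x ≡ 0# → x ≡ 0#
  J≡0⇒≡0 {x} Jx≡0 = ⁻¹-injective (trans (sym (J-J x)) (trans (cong J Jx≡0) (trans J-0 (sym ε⁻¹≈ε))))

  open SignedOrbits -_ J true ⁻¹-involutive J-‿ J-J public using (orbit; orbit-shared)

  orbit-unique : ∀ {x} → x ≢ 0# → Unique (orbit x)
  orbit-unique {x} x≢0 =
      ( (x≢0 ∘ J≡⇒≡0 ∘ sym)
      ∷ (x≢0 ∘ ≡-‿⇒≡0)
      ∷ (λ x≡-Jx → x≢0 (J≡-‿⇒≡0 (sym (trans (cong -_ x≡-Jx) (⁻¹-involutive (J x))))))
      ∷ [])
    ∷ ((x≢0 ∘ J≡-‿⇒≡0) ∷ (x≢0 ∘ J≡0⇒≡0 ∘ ≡-‿⇒≡0) ∷ [])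
    ∷ ((x≢0 ∘ J≡⇒≡0 ∘ sym ∘ ⁻¹-injective) ∷ [])
    ∷ [] ∷ []

  0∈orbit⇒≡0 : ∀ {x} → 0# ∈ orbit x → x ≡ 0#
  0∈orbit⇒≡0 (here 0≡x)                         = sym 0≡x
  0∈orbit⇒≡0 (there (here 0≡Jx))                = J≡0⇒≡0 (sym 0≡Jx)
  0∈orbit⇒≡0 (there (there (here 0≡-x)))        = ⁻¹-injective (trans (sym 0≡-x) (sym ε⁻¹≈ε))
  0∈orbit⇒≡0 (there (there (there (here 0≡-Jx)))) = J≡0⇒≡0 (⁻¹-injective (trans (sym 0≡-Jx) (sym ε⁻¹≈ε)))

  record Automorphism : Set where
    field
      to from      : Carrier → Carrier
      to-+         : ∀ x y → to (x + y) ≡ to x + to y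
      to-J         : ∀ x → to (J x) ≡ J (to x)
      to-injective : ∀ {x y} → to x ≡ to y → x ≡ y
      to-from      : ∀ r → to (from r) ≡ r

    open Endomorphism to to-+ using (f-0; f-‿)

    from-0 : from 0# ≡ 0#
    from-0 = to-injective (trans (to-from 0#) (sym f-0))

    from-≢0 : ∀ {r} → r ≢ 0# → from r ≢ 0#
    from-≢0 {r} r≢0 from-r≡0 = r≢0 (trans (sym (to-from r)) (trans (cong to from-r≡0) f-0))

    map-orbit : ∀ x → map to (orbit x) ≡ orbit (to x)
    map-orbit x = cong₂ (λ a b → to x ∷ a ∷ b) (to-J x)
                        (cong₂ (λ a b → a ∷ b ∷ []) (f-‿ x) (trans (f-‿ (J x)) (cong -_ (to-J x))))

    count-orbit : ∀ r x → count _≟_ r (orbit (to x)) ≡ count _≟_ (from r) (orbit x)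
    count-orbit r x = trans (cong (count _≟_ r) (sym (map-orbit x)))
      (count-map _≟_ _≟_ to (to-from r) (λ to-y≡r → to-injective (trans to-y≡r (sym (to-from r)))) (orbit x))

  doubling : Automorphism
  doubling = record
    { to           = λ x → x + x
    ; from         = half
    ; to-+         = λ x y → interchange x y x y
    ; to-J         = λ x → sym (J-+ x x)
    ; to-injective = λ {x} {y} x+x≡y+y → trans (sym (half-double x)) (trans (cong half x+x≡y+y) (half-double y))
    ; to-from      = half+half
    }

  J-minus-1 : Automorphism
  J-minus-1 = record
    { to           = to
    ; from         = from
    ; to-+         = to-+
    ; to-J         = λ x → sym (trans (J-+ (J x) (- x)) (cong (J (J x) +_) (J-‿ x)))
    ; to-injective = to-injective
    ; to-from      = to-from
    }
    where
    to from : Carrier → Carrier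
    to x = J x - x
    from r = J (- half r) + - half r

    to-+ : ∀ x y → to (x + y) ≡ to x + to y
    to-+ x y = trans (cong₂ _+_ (J-+ x y) (-‿+ x y)) (interchange (J x) (J y) (- x) (- y))

    to-injective : ∀ {x y} → to x ≡ to y → x ≡ y
    to-injective {x} {y} to-x≡to-y = x∙y⁻¹≈ε⇒x≈y x y (J≡⇒≡0 (x∙y⁻¹≈ε⇒x≈y _ _ (begin
      to (x - y)        ≡⟨ Endomorphism.f-- to to-+ x y ⟩
      to x - to y       ≡⟨ cong (_- to y) to-x≡to-y ⟩
      to y - to y       ≡⟨ inverseʳ (to y) ⟩
      0#                ∎)))

    to-from : ∀ r → to (from r) ≡ r
    to-from r = begin
      J (J u + u) - (J u + u)                ≡⟨ to-+ (J u) u ⟩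
      (J (J u) - J u) + (J u - u)            ≡⟨ cong (λ w → (w - J u) + (J u - u)) (J-J u) ⟩
      (- u - J u) + (J u - u)                ≡⟨ cong ((- u - J u) +_) (comm (J u) (- u)) ⟩
      (- u - J u) + (- u + J u)              ≡⟨ interchange (- u) (- J u) (- u) (J u) ⟩
      (- u - u) + (- J u + J u)              ≡⟨ cong ((- u - u) +_) (inverseˡ (J u)) ⟩
      (- u - u) + 0#                         ≡⟨ identityʳ _ ⟩
      - u - u                                ≡⟨ cong₂ _+_ (⁻¹-involutive (half r)) (⁻¹-involutive (half r)) ⟩
      half r + half r                        ≡⟨ half+half r ⟩
      r                                      ∎
      where
      u : Carrier
      u = - half r

-- The Banff difference family

module BanffFamily (R : QuarterTurnGroup) where
  open QuarterTurnProperties R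

  G : FiniteAbelianGroup
  G = Modular.group 3 ×ᴳ group

  open FiniteAbelianGroup G using () renaming (_≟_ to _≟ᴳ_)
  open Differences G using (differences₄; differences≡differences₄)
  open OrbitRepresentatives _≟_ orbit (λ _ → here refl) orbit-shared

  H-members : List (Fin 3 × Carrier)
  H-members = (zero , 0#) ∷ (suc zero , 0#) ∷ (suc (suc zero) , 0#) ∷ []

  ∈H⇒≡0 : ∀ {z} → z ∈ H-members → proj₂ z ≡ 0#
  ∈H⇒≡0 (here refl)                 = refl
  ∈H⇒≡0 (there (here refl))         = refl
  ∈H⇒≡0 (there (there (here refl))) = refl

  ≡0⇒∈H : ∀ {z} → proj₂ z ≡ 0# → z ∈ H-members
  ≡0⇒∈H {zero , _}             refl = here refl
  ≡0⇒∈H {suc zero , _}         refl = there (here refl)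
  ≡0⇒∈H {suc (suc zero) , _}   refl = there (there (here refl))

  H : Subgroup G
  H = record
    { members    = H-members
    ; distinct   = ((λ ()) ∷ (λ ()) ∷ []) ∷ ((λ ()) ∷ []) ∷ [] ∷ []
    ; has-0      = here refl
    ; +-closed   = λ a∈ b∈ → ≡0⇒∈H (trans (cong₂ _+_ (∈H⇒≡0 a∈) (∈H⇒≡0 b∈)) (identityˡ 0#))
    ; neg-closed = λ a∈ → ≡0⇒∈H (trans (cong -_ (∈H⇒≡0 a∈)) ε⁻¹≈ε)
    }

  nonzero : List Carrier
  nonzero = filter (λ x → ¬? (x ≟ 0#)) elements

  nonzero⁺ : ∀ {x} → x ≢ 0# → x ∈ nonzero
  nonzero⁺ {x} = ∈-filter⁺ (λ x → ¬? (x ≟ 0#)) (complete x)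

  nonzero⁻ : ∀ {x} → x ∈ nonzero → x ≢ 0#
  nonzero⁻ = proj₂ ∘ ∈-filter⁻ (λ x → ¬? (x ≟ 0#)) {xs = elements}

  orbits : List Carrier
  orbits = covered nonzero

  orbits-unique : Unique orbits
  orbits-unique = covered-unique nonzero (orbit-unique ∘ nonzero⁻)

  representative-≢0 : ∀ {x} → x ∈ representatives nonzero → x ≢ 0#
  representative-≢0 = nonzero⁻ ∘ representatives-⊆ nonzero

  0∉orbits : 0# ∉ orbits
  0∉orbits 0∈ with find (∈-concatMap⁻ orbit {xs = representatives nonzero} 0∈)
  ... | x , x∈ , 0∈orbit-x = representative-≢0 x∈ (0∈orbit⇒≡0 0∈orbit-x)

  block : Carrier → List (Fin 3 × Carrier)
  block x = (suc zero , x) ∷ (suc (suc zero) , J x) ∷ (suc zero , - x) ∷ (suc (suc zero) , - J x) ∷ []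

  family : List (List (Fin 3 × Carrier))
  family = map block (representatives nonzero)

  block-unique : ∀ {x} → x ≢ 0# → Unique (block x)
  block-unique x≢0 with orbit-unique x≢0
  ... | (_ ∷ x≢-x ∷ _ ∷ []) ∷ (_ ∷ Jx≢-Jx ∷ []) ∷ _ =
      ((λ ()) ∷ (x≢-x ∘ cong proj₂) ∷ (λ ()) ∷ [])
    ∷ ((λ ()) ∷ (Jx≢-Jx ∘ cong proj₂) ∷ [])
    ∷ ((λ ()) ∷ [])
    ∷ [] ∷ []

  differenceAutomorphism : Fin 3 → Automorphism
  differenceAutomorphism zero    = doubling
  differenceAutomorphism (suc _) = J-minus-1

  private
    ↭-adbc : ∀ {a b c d : Carrier} → a ∷ d ∷ b ∷ c ∷ [] ↭ a ∷ b ∷ c ∷ d ∷ []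
    ↭-adbc {a} {b} {c} {d} = ↭-prep a (↭-trans (↭-swap d b ↭-refl) (↭-prep b (↭-swap d c ↭-refl)))

    ↭-cdba : ∀ {a b c d : Carrier} → c ∷ d ∷ b ∷ a ∷ [] ↭ a ∷ b ∷ c ∷ d ∷ []
    ↭-cdba {a} {b} {c} {d} = ↭-trans (↭-swap c d ↭-refl) (↭-reverse (a ∷ b ∷ c ∷ d ∷ []))

    J[Jx-x] : ∀ x → J (J x - x) ≡ - x - J x
    J[Jx-x] x = trans (J-+ (J x) (- x)) (cong₂ _+_ (J-J x) (J-‿ x))

    -J[Jx-x] : ∀ x → - J (J x - x) ≡ x + J x
    -J[Jx-x] x = trans (cong -_ (J[Jx-x] x)) (trans (-‿+ (- x) (- J x)) (cong₂ _+_ (⁻¹-involutive x) (⁻¹-involutive (J x))))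

  coordinate : Fin 3 → List (Fin 3 × Carrier) → List Carrier
  coordinate t = map proj₂ ∘ filter ((t Fin.≟_) ∘ proj₁)

  coordinate-differences-↭ : ∀ t {x} → x ≢ 0# →
                             coordinate t (differences G (block x)) ↭ orbit (Automorphism.to (differenceAutomorphism t) x)
  coordinate-differences-↭ t {x} x≢0 rewrite differences≡differences₄ (block-unique x≢0) = by-coordinate t
    where
    by-coordinate : ∀ t → coordinate t (differences₄ (suc zero , x) (suc (suc zero) , J x)
                                                      (suc zero , - x) (suc (suc zero) , - J x))
                        ↭ orbit (Automorphism.to (differenceAutomorphism t) x)
    by-coordinate zero = ↭-reflexive (Pointwise-≡⇒≡
      ( cong (x +_) (⁻¹-involutive x)
      ∷ trans (cong (J x +_) (⁻¹-involutive (J x))) (sym (J-+ x x))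
      ∷ sym (-‿+ x x)
      ∷ trans (sym (-‿+ (J x) (J x))) (cong -_ (sym (J-+ x x)))
      ∷ []))
    by-coordinate (suc zero) = ↭-trans (↭-reflexive (Pointwise-≡⇒≡
      ( refl
      ∷ trans (cong (J x +_) (⁻¹-involutive x)) (trans (comm (J x) x) (sym (-J[Jx-x] x)))
      ∷ trans (comm (- J x) (- x)) (sym (J[Jx-x] x))
      ∷ sym (-‿+ (J x) (- x))
      ∷ []))) ↭-adbc
    by-coordinate (suc (suc zero)) = ↭-trans (↭-reflexive (Pointwise-≡⇒≡
      ( trans (comm x (- J x)) (trans (cong (- J x +_) (sym (⁻¹-involutive x))) (sym (-‿+ (J x) (- x))))
      ∷ trans (cong (x +_) (⁻¹-involutive (J x))) (sym (-J[Jx-x] x))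
      ∷ sym (J[Jx-x] x)
      ∷ trans (cong (- x +_) (⁻¹-involutive (J x))) (comm (- x) (J x))
      ∷ []))) ↭-cdba

  count-differences-block : ∀ t r {x} → x ≢ 0# →
    count _≟ᴳ_ (t , r) (differences G (block x)) ≡ count _≟_ (Automorphism.from (differenceAutomorphism t) r) (orbit x)
  count-differences-block t r {x} x≢0 = begin
    count _≟ᴳ_ (t , r) (differences G (block x))                          ≡⟨ count-× Fin._≟_ _≟_ t r (differences G (block x)) ⟩
    count _≟_ r (coordinate t (differences G (block x)))                   ≡⟨ count-↭ _≟_ r (coordinate-differences-↭ t x≢0) ⟩
    count _≟_ r (orbit (Automorphism.to (differenceAutomorphism t) x))      ≡⟨ Automorphism.count-orbit (differenceAutomorphism t) r x ⟩
    count _≟_ (Automorphism.from (differenceAutomorphism t) r) (orbit x)    ∎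

  count-allDifferences : ∀ t r → count _≟ᴳ_ (t , r) (allDifferences G family) ≡
                         count _≟_ (Automorphism.from (differenceAutomorphism t) r) orbits
  count-allDifferences t r = trans (cong (count _≟ᴳ_ (t , r)) (concatMap-map (differences G) block (representatives nonzero)))
    (count-concatMap-cong _≟ᴳ_ _≟_ (differences G ∘ block) orbit (representatives nonzero)
      (λ x∈ → count-differences-block t r (representative-≢0 x∈)))

  isRDF : IsRDF G H 4 1 family
  isRDF = block-isKSubset , count-∉H , count-∈H
    where
    block-isKSubset : ∀ {B} → B ∈ family → IsKSubset G 4 B
    block-isKSubset B∈ with ∈-map⁻ block B∈
    ... | x , x∈ , refl = block-unique (representative-≢0 x∈) , refl

    count-∉H : ∀ g → g ∉ H-members → count _≟ᴳ_ g (allDifferences G family) ≡ 1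
    count-∉H (t , r) g∉H = trans (count-allDifferences t r)
      (count-∈ _≟_ orbits-unique (⊆-covered nonzero (nonzero⁺ (from-≢0 (g∉H ∘ ≡0⇒∈H)))))
      where open Automorphism (differenceAutomorphism t) using (from-≢0)

    count-∈H : ∀ g → g ∈ H-members → count _≟ᴳ_ g (allDifferences G family) ≡ 0
    count-∈H (t , r) g∈H = trans (count-allDifferences t r)
      (count-∉ _≟_ (subst (_∉ orbits) (sym (trans (cong from (∈H⇒≡0 g∈H)) from-0)) 0∉orbits))
      where open Automorphism (differenceAutomorphism t) using (from; from-0)

  signed-block-⊆-orbit : ∀ s x {z} → z ∈ signed G s (block x) → proj₂ z ∈ orbit x
  signed-block-⊆-orbit true  x (here refl)                         = here refl
  signed-block-⊆-orbit true  x (there (here refl))                 = there (here refl)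
  signed-block-⊆-orbit true  x (there (there (here refl)))         = there (there (here refl))
  signed-block-⊆-orbit true  x (there (there (there (here refl)))) = there (there (there (here refl)))
  signed-block-⊆-orbit false x (here refl)                         = there (there (here refl))
  signed-block-⊆-orbit false x (there (here refl))                 = there (there (there (here refl)))
  signed-block-⊆-orbit false x (there (there (here refl)))         = here (⁻¹-involutive x)
  signed-block-⊆-orbit false x (there (there (there (here refl)))) = there (here (⁻¹-involutive (J x)))

  block∩negSet≡∅ : ∀ {x} → x ≢ 0# → Disjoint G (block x) (negSet G (block x))
  block∩negSet≡∅ {x} x≢0 = disjoint (orbit-unique x≢0)
    where
    disjoint : Unique (orbit x) → Disjoint G (block x) (negSet G (block x))
    disjoint ((x≢Jx ∷ _ ∷ x≢-Jx ∷ []) ∷ (Jx≢-x ∷ _ ∷ []) ∷ (-x≢-Jx ∷ []) ∷ _ ∷ []) = λ where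
      (here refl) (there (here e))                         → x≢-Jx (cong proj₂ e)
      (here refl) (there (there (there (here e))))         → x≢Jx (trans (cong proj₂ e) (⁻¹-involutive (J x)))
      (there (here refl)) (here e)                         → Jx≢-x (cong proj₂ e)
      (there (here refl)) (there (there (here e)))         → x≢Jx (sym (trans (cong proj₂ e) (⁻¹-involutive x)))
      (there (here refl)) (there (there (there (here ()))))
      (there (here refl)) (there (there (there (there ()))))
      (there (there (here refl))) (there (here e))         → -x≢-Jx (cong proj₂ e)
      (there (there (here refl))) (there (there (there (here e)))) → Jx≢-x (sym (trans (cong proj₂ e) (⁻¹-involutive (J x))))
      (there (there (there (here refl)))) (here e)         → -x≢-Jx (sym (cong proj₂ e))
      (there (there (there (here refl)))) (there (there (here e))) → x≢-Jx (sym (trans (cong proj₂ e) (⁻¹-involutive x)))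
      (there (there (there (here refl)))) (there (there (there (here ()))))
      (there (there (there (here refl)))) (there (there (there (there ()))))

  signed-lookup-⊆-covered : ∀ xs j t {z} → z ∈ signed G t (lookup (map block xs) j) → proj₂ z ∈ concatMap orbit xs
  signed-lookup-⊆-covered (x ∷ xs) zero    t z∈ = ∈-++⁺ˡ (signed-block-⊆-orbit t x z∈)
  signed-lookup-⊆-covered (x ∷ xs) (suc j) t z∈ = ∈-++⁺ʳ (orbit x) (signed-lookup-⊆-covered xs j t z∈)

  signed-blocks-disjoint : ∀ xs → (∀ {x} → x ∈ xs → x ≢ 0#) → Unique (concatMap orbit xs) →
    ∀ i j s t → (i , s) ≢ (j , t) →
    Disjoint G (signed G s (lookup (map block xs) i)) (signed G t (lookup (map block xs) j))
  signed-blocks-disjoint (x ∷ xs) xs≢0 xs! zero zero true  true  is≢jt = ⊥-elim (is≢jt refl)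
  signed-blocks-disjoint (x ∷ xs) xs≢0 xs! zero zero false false is≢jt = ⊥-elim (is≢jt refl)
  signed-blocks-disjoint (x ∷ xs) xs≢0 xs! zero zero true  false _     = block∩negSet≡∅ (xs≢0 (here refl))
  signed-blocks-disjoint (x ∷ xs) xs≢0 xs! zero zero false true  _     = flip (block∩negSet≡∅ (xs≢0 (here refl)))
  signed-blocks-disjoint (x ∷ xs) xs≢0 xs! zero (suc j) s t _ = λ z∈ z∈′ →
    Unique-++⇒∉ (orbit x) xs! (signed-block-⊆-orbit s x z∈) (signed-lookup-⊆-covered xs j t z∈′)
  signed-blocks-disjoint (x ∷ xs) xs≢0 xs! (suc i) zero s t _ = λ z∈ z∈′ →
    Unique-++⇒∉ (orbit x) xs! (signed-block-⊆-orbit t x z∈′) (signed-lookup-⊆-covered xs i s z∈)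
  signed-blocks-disjoint (x ∷ xs) xs≢0 xs! (suc i) (suc j) s t is≢jt =
    signed-blocks-disjoint xs (xs≢0 ∘ there) (Unique-++⁻ʳ (orbit x) xs!) i j s t (is≢jt ∘ cong (Product.map₁ suc))

  isBRDF : IsBRDF G H 4 1 family
  isBRDF = isRDF , blocks-avoid-H
         , signed-blocks-disjoint (representatives nonzero) representative-≢0 orbits-unique
    where
    blocks-avoid-H : ∀ {B} → B ∈ family → Disjoint G B H-members
    blocks-avoid-H B∈ with ∈-map⁻ block B∈
    ... | x , x∈ , refl = λ z∈B z∈H →
      representative-≢0 x∈ (0∈orbit⇒≡0 (subst (_∈ orbit x) (∈H⇒≡0 z∈H) (signed-block-⊆-orbit true x z∈B)))

quarterTurnGroup⇒BRDF : (R : QuarterTurnGroup) → BRDFExists (3 ℕ.* QuarterTurnGroup.order R) 3 4 1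
quarterTurnGroup⇒BRDF R = G , H , family , order-×ᴳ (Modular.group 3) (QuarterTurnGroup.group R) , refl , isBRDF
  where open BanffFamily R

-- Prime factorisation

open import Data.Nat using (_+_; _*_; _^_)
open +-*-Solver

data Mod4 : ℕ → Set where
  4q   : ∀ q → Mod4 (q * 4)
  4q+1 : ∀ q → Mod4 (1 + q * 4)
  4q+2 : ∀ q → Mod4 (2 + q * 4)
  4q+3 : ∀ q → Mod4 (3 + q * 4)

mod4 : ∀ n → Mod4 n
mod4 0 = 4q 0
mod4 1 = 4q+1 0
mod4 2 = 4q+2 0
mod4 3 = 4q+3 0
mod4 (suc (suc (suc (suc n)))) with mod4 n
... | 4q q   = 4q (suc q)
... | 4q+1 q = 4q+1 (suc q)
... | 4q+2 q = 4q+2 (suc q)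
... | 4q+3 q = 4q+3 (suc q)

even⇒%4≢1 : ∀ {n} → 2 ∣ n → n % 4 ≢ 1
even⇒%4≢1 {n} 2∣n n%4≡1 = 2≢1 (∣1⇒≡1 (∣m+n∣m⇒∣n 2∣[n/4]*4+1 (∣n⇒∣m*n (n / 4) (divides 2 refl))))
  where
  2≢1 : 2 ≢ 1
  2≢1 ()
  2∣[n/4]*4+1 : 2 ∣ n / 4 * 4 + 1
  2∣[n/4]*4+1 = subst (2 ∣_) (trans (m≡m%n+[m/n]*n n 4) (trans (cong (_+ n / 4 * 4) n%4≡1) (ℕ.+-comm 1 _))) 2∣n

3-mod-4-power : ∀ {n} → n % 4 ≡ 3 → ∀ e →
                (∃ λ f → e ≡ f + f × n ^ e % 4 ≡ 1) ⊎ (∃ λ f → e ≡ suc (f + f) × n ^ e % 4 ≡ 3)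
3-mod-4-power n%4≡3 zero = inj₁ (0 , refl , refl)
3-mod-4-power {n} n%4≡3 (suc e) with 3-mod-4-power {n} n%4≡3 e
... | inj₁ (f , refl , nᵉ%4≡1) = inj₂ (f , refl ,
      trans (%-distribˡ-* n (n ^ e) 4) (cong₂ (λ a b → (a * b) % 4) n%4≡3 nᵉ%4≡1))
... | inj₂ (f , refl , nᵉ%4≡3) = inj₁ (suc f , cong suc (sym (ℕ.+-suc f f)) ,
      trans (%-distribˡ-* n (n ^ e) 4) (cong₂ (λ a b → (a * b) % 4) n%4≡3 nᵉ%4≡3))

[m*m]^n≡m^[n+n] : ∀ m n → (m * m) ^ n ≡ m ^ (n + n)
[m*m]^n≡m^[n+n] m n = begin
  (m * m) ^ n          ≡⟨ cong (λ k → (m * k) ^ n) (ℕ.*-identityʳ m) ⟨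
  (m ^ 2) ^ n          ≡⟨ ℕ.^-*-assoc m 2 n ⟩
  m ^ (2 * n)          ≡⟨ cong (m ^_) (solve 1 (λ n → con 2 :* n := n :+ n) refl n) ⟩
  m ^ (n + n)          ∎

quarterTurn-1mod4 : ∀ q → Prime (1 + q * 4) → QuarterTurnGroupOfOrder (1 + q * 4)
quarterTurn-1mod4 q p-prime =
  ℤ-quarterTurn (1 + q * 4) (Modular.[ 1 + q * 4 ] (suc (q + q))) (proj₁ ∃-sqrt-1)
                (Modular.[1+k]+[1+k]≡1 (1 + q * 4) (q + q) p-odd) (proj₂ ∃-sqrt-1)
  where open SquareRootOfMinusOne q p-prime using (p-odd; ∃-sqrt-1)

quarterTurn-3mod4² : ∀ q → QuarterTurnGroupOfOrder ((3 + q * 4) * (3 + q * 4))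
quarterTurn-3mod4² q = subst (λ n → QuarterTurnGroupOfOrder (n * n)) (sym 3+4q≡1+2k) (ℤ²-quarterTurn k)
  where
  k : ℕ
  k = suc (q * 2)
  3+4q≡1+2k : 3 + q * 4 ≡ suc (k + k)
  3+4q≡1+2k = solve 1 (λ q → con 3 :+ q :* con 4 := con 1 :+ ((con 1 :+ q :* con 2) :+ (con 1 :+ q :* con 2))) refl q

prime-power-quarterTurn : ∀ {p e} → Prime p → 1 ≤ e → p ^ e % 4 ≡ 1 → QuarterTurnGroupOfOrder (p ^ e)
prime-power-quarterTurn {p} {suc e} p-prime (s≤s z≤n) pᵉ%4≡1 with mod4 p
... | 4q q   = ⊥-elim (even⇒%4≢1 (∣m⇒∣m*n (p ^ e) (∣n⇒∣m*n q (divides 2 refl))) pᵉ%4≡1)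
... | 4q+2 q = ⊥-elim (even⇒%4≢1 (∣m⇒∣m*n (p ^ e) (∣m∣n⇒∣m+n ∣-refl (∣n⇒∣m*n q (divides 2 refl)))) pᵉ%4≡1)
... | 4q+1 q = quarterTurn-1mod4 q p-prime ⊗^ suc e
... | 4q+3 q with 3-mod-4-power {p} ([m+kn]%n≡m%n 3 q 4) (suc e)
...   | inj₁ (f , 1+e≡f+f , _)  = subst QuarterTurnGroupOfOrder
                                       (trans ([m*m]^n≡m^[n+n] p f) (cong (p ^_) (sym 1+e≡f+f)))
                                       (quarterTurn-3mod4² q ⊗^ f)
...   | inj₂ (_ , _ , pᵉ%4≡3) = ⊥-elim (3≢1 (trans (sym pᵉ%4≡3) pᵉ%4≡1))
  where
  3≢1 : 3 ≢ 1
  3≢1 ()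

prime∤prime^ : ∀ {p q} → Prime q → Prime p → q ≢ p → ∀ e → q ∤ p ^ e
prime∤prime^ q-prime p-prime q≢p zero q∣1 = ℕ.<-irrefl (sym (∣1⇒≡1 q∣1)) (prime>1 q-prime)
prime∤prime^ {p} q-prime p-prime q≢p (suc e) q∣pᵉ⁺¹ with euclidsLemma p (p ^ e) q-prime q∣pᵉ⁺¹
... | inj₂ q∣pᵉ = prime∤prime^ q-prime p-prime q≢p e q∣pᵉ
... | inj₁ q∣p with prime⇒irreducible p-prime q∣p
...   | inj₁ q≡1 = ℕ.<-irrefl (sym q≡1) (prime>1 q-prime)
...   | inj₂ q≡p = q≢p q≡p

prime^∣*⇒∣ : ∀ {q a} → Prime q → q ∤ a → ∀ n {b} → q ^ n ∣ a * b → q ^ n ∣ b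
prime^∣*⇒∣ q-prime q∤a zero {b} _ = divides b (sym (ℕ.*-identityʳ b))
prime^∣*⇒∣ {q} {a} q-prime q∤a (suc n) {b} qⁿ⁺¹∣ab
  with euclidsLemma a b q-prime (∣-trans (m∣m*n (q ^ n)) qⁿ⁺¹∣ab)
... | inj₁ q∣a = ⊥-elim (q∤a q∣a)
... | inj₂ (divides c refl) = subst (q * q ^ n ∣_) (ℕ.*-comm q c) (*-monoʳ-∣ q qⁿ∣c)
  where
  instance
    q≢0 : NonZero q
    q≢0 = prime⇒nonZero q-prime
  qⁿ∣c : q ^ n ∣ c
  qⁿ∣c = prime^∣*⇒∣ q-prime q∤a n (*-cancelˡ-∣ q
           (subst (q * q ^ n ∣_) (solve 3 (λ a c q → a :* (c :* q) := q :* (a :* c)) refl a c q) qⁿ⁺¹∣ab))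

p-adic-split : ∀ {p} → 1 < p → ∀ v → 1 ≤ v → ∃₂ λ e w → v ≡ p ^ e * w × p ∤ w
p-adic-split {p} 1<p v = split v (<-wellFounded v)
  where
  split : ∀ v → Acc _<_ v → 1 ≤ v → ∃₂ λ e w → v ≡ p ^ e * w × p ∤ w
  split v (acc rec) 1≤v with p ∣? v
  ... | no p∤v = 0 , v , sym (ℕ.+-identityʳ v) , p∤v
  ... | yes (divides zero refl) = ⊥-elim (ℕ.<-irrefl refl 1≤v)
  ... | yes (divides w@(suc _) refl) with split w (rec (ℕ.m<m*n w p 1<p)) (s≤s z≤n)
  ...   | e , u , w≡pᵉu , p∤u = suc e , u , (begin
    w * p             ≡⟨ cong (_* p) w≡pᵉu ⟩
    p ^ e * u * p     ≡⟨ solve 3 (λ pᵉ u p → pᵉ :* u :* p := p :* pᵉ :* u) refl (p ^ e) u p ⟩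
    p * p ^ e * u     ∎) , p∤u

MaximalPrimePowers≡1mod4 : ℕ → Set
MaximalPrimePowers≡1mod4 v = ∀ p e → MaximalPrimePowerFactor v p e → p ^ e % 4 ≡ 1

maximalPrimePowerFactor : ∀ {p e w} → Prime p → p ∤ w → MaximalPrimePowerFactor (p ^ suc e * w) p (suc e)
maximalPrimePowerFactor {p} {e} {w} p-prime p∤w = p-prime , s≤s z≤n , m∣m*n w , λ pᵉ⁺²∣ →
  p∤w (*-cancelˡ-∣ (p ^ suc e) {{ℕ.m^n≢0 p (suc e) {{prime⇒nonZero p-prime}}}}
                   (subst (_∣ p ^ suc e * w) (ℕ.*-comm p (p ^ suc e)) pᵉ⁺²∣))

MaximalPrimePowers≡1mod4-cofactor : ∀ {p e w} → Prime p → p ∤ w →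
                                    MaximalPrimePowers≡1mod4 (p ^ e * w) → MaximalPrimePowers≡1mod4 w
MaximalPrimePowers≡1mod4-cofactor {p} {e} {w} p-prime p∤w hyp q (suc f) (q-prime , s≤s z≤n , qᶠ⁺¹∣w , qᶠ⁺²∤w) =
  hyp q (suc f) (q-prime , s≤s z≤n , ∣n⇒∣m*n (p ^ e) qᶠ⁺¹∣w ,
                 qᶠ⁺²∤w ∘ prime^∣*⇒∣ q-prime (prime∤prime^ q-prime p-prime q≢p e) (suc (suc f)))
  where
  q≢p : q ≢ p
  q≢p refl = p∤w (∣-trans (m∣m*n (q ^ f)) qᶠ⁺¹∣w)

∃-prime-divisor : ∀ {n} → 1 < n → ∃ λ p → Prime p × p ∣ n
∃-prime-divisor {suc zero} (s≤s ())
∃-prime-divisor {n@(suc (suc _))} _ with factorise n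
... | record { factors = p ∷ ps ; isFactorisation = n≡p*ps ; factorsPrime = p-prime ∷ _ } =
  p , p-prime , divides (product ps) (trans n≡p*ps (ℕ.*-comm p (product ps)))

quarterTurnGroup-of-order : ∀ v → 1 ≤ v → MaximalPrimePowers≡1mod4 v → QuarterTurnGroupOfOrder v
quarterTurnGroup-of-order v = build v (<-wellFounded v)
  where
  build : ∀ v → Acc _<_ v → 1 ≤ v → MaximalPrimePowers≡1mod4 v → QuarterTurnGroupOfOrder v
  build 1 _ _ _ = ℤ₁-quarterTurn
  build v@(suc (suc _)) (acc rec) 1≤v hyp with ∃-prime-divisor {v} (s≤s (s≤s z≤n))
  ... | p , p-prime , p∣v with p-adic-split (prime>1 p-prime) v 1≤v
  ...   | zero , w , v≡w , p∤w = ⊥-elim (p∤w (subst (p ∣_) (trans v≡w (ℕ.+-identityʳ w)) p∣v))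
  ...   | suc e , zero , v≡0 , _ = ⊥-elim (ℕ.1+n≢0 (trans v≡0 (ℕ.*-zeroʳ (p ^ suc e))))
  ...   | suc e , w@(suc _) , v≡pᵉw , p∤w = subst QuarterTurnGroupOfOrder (sym v≡pᵉw) (prime-power ⊗ cofactor)
    where
    hyp′ : MaximalPrimePowers≡1mod4 (p ^ suc e * w)
    hyp′ = subst MaximalPrimePowers≡1mod4 v≡pᵉw hyp

    prime-power : QuarterTurnGroupOfOrder (p ^ suc e)
    prime-power = prime-power-quarterTurn {e = suc e} p-prime (s≤s z≤n)
                    (hyp′ p (suc e) (maximalPrimePowerFactor {e = e} p-prime p∤w))

    1<pᵉ : 1 < p ^ suc e
    1<pᵉ = ℕ.<-≤-trans (prime>1 p-prime) (ℕ.m≤m*n p (p ^ e) {{ℕ.m^n≢0 p e {{prime⇒nonZero p-prime}}}})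

    w<v : w < v
    w<v = subst (w <_) (trans (ℕ.*-comm w (p ^ suc e)) (sym v≡pᵉw)) (ℕ.m<m*n w (p ^ suc e) 1<pᵉ)

    cofactor : QuarterTurnGroupOfOrder w
    cofactor = build w (rec w<v) (s≤s z≤n) (MaximalPrimePowers≡1mod4-cofactor {e = suc e} p-prime p∤w hyp′)

theorem3p1 : (v : ℕ) → 1 ≤ v →
    (∀ p e → MaximalPrimePowerFactor v p e → (p ^ e) % 4 ≡ 1) →
    BRDFExists (3 * v) 3 4 1
theorem3p1 v 1≤v hyp with quarterTurnGroup-of-order v 1≤v hyp
... | R , |R|≡v = subst (λ n → BRDFExists (3 * n) 3 4 1) |R|≡v (quarterTurnGroup⇒BRDF R)
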